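{- Let $m\ge1$ and $r_1,\dots,r_m\ge0$ be integers, and let $\tilde c_k(\mathbf r)$ be the number of ways to choose multisets $M_1,\dots,M_m$ of elements of $[k]=\{1,\dots,k\}$, of respective cardinalities (counted with multiplicity) $r_1,\dots,r_m$, such that every element of $[k]$ occurs in at least one $M_i$. Then, as polynomials in $x$, $$\left(\!\!\binom{x}{r_1}\!\!\right)\cdots\left(\!\!\binom{x}{r_m}\!\!\right)=\sum_{k\ge0}\tilde c_k(\mathbf r)\binom xk .$$ In particular, for $m=2$, $$\tilde c_k(r_1,r_2)=\sum_{\substack{l,k_1,k_2\ge0\\ k_1+k_2-l=k}}\frac{k!}{l!\,(k_1-l)!\,(k_2-l)!}\binom{r_1-1}{k_1-1}\binom{r_2-1}{k_2-1}.$$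
   Context: $\left(\!\binom{x}{n}\!\right)=\binom{x+n-1}{n}=\frac{x(x+1)\cdots(x+n-1)}{n!}$ (the number of multisets of size $n$ from an $x$-element set when $x\in\mathbb N$); $\binom xk=x(x-1)\cdots(x-k+1)/k!$. Binomial coefficients $\binom{a}{b}$ with $b<0$ or with $b>a\ge0$ are $0$, while $\binom{ -1}{ -1}=1$ (so that $\binom{r-1}{k'-1}$ counts multisets of size $r$ with support of size exactly $k'$); terms of the multinomial with a negative lower index are $0$. -}

module Defs where

open import Data.Bool using (Bool; true; false; if_then_else_; _∧_; _∨_)
open import Data.Nat as ℕ using (ℕ; zero; suc; _∸_; _≤ᵇ_; _!)
open import Data.Nat.Properties using (_!≢0; _!*_!≢0; m*n≢0)
open import Data.Nat.Combinatorics using (_C_)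
open import Data.Nat.DivMod using (_/_)
open import Data.Fin using (Fin)
open import Data.List using (List; []; _∷_; [_]; map; concatMap; upTo; allFin; foldr)
open import Data.Vec as Vec using (Vec; []; _∷_; lookup)
open import Data.Integer using (+_)
open import Data.Rational as ℚ using (ℚ; 0ℚ; 1ℚ)

ℕtoℚ : ℕ → ℚ
ℕtoℚ n = (+ n) ℚ./ 1

inv! : ℕ → ℚ
inv! n = ((+ 1) ℚ./ (n !)) {{n !≢0}}

rising : ℚ → ℕ → ℚ
rising x zero    = 1ℚ
rising x (suc n) = rising x n ℚ.* (x ℚ.+ ℕtoℚ n)

falling : ℚ → ℕ → ℚ
falling x zero    = 1ℚ
falling x (suc n) = falling x n ℚ.* (x ℚ.- ℕtoℚ n)

mset : ℚ → ℕ → ℚ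
mset x n = rising x n ℚ.* inv! n

binomℚ : ℚ → ℕ → ℚ
binomℚ x k = falling x k ℚ.* inv! k

prodℚ : ∀ {m} → Vec ℚ m → ℚ
prodℚ []       = 1ℚ
prodℚ (q ∷ qs) = q ℚ.* prodℚ qs

sumTo : ℕ → (ℕ → ℚ) → ℚ
sumTo zero    f = f 0
sumTo (suc N) f = sumTo N f ℚ.+ f (suc N)

sumVec : ∀ {m} → Vec ℕ m → ℕ
sumVec []       = 0
sumVec (r ∷ rs) = r ℕ.+ sumVec rs

-- A multiset of elements of [k] = Fin k is given by its multiplicity
-- vector (M j = multiplicity of j).  `multisets k r` lists every
-- multiplicity vector of length k whose entries sum to r, i.e. every
-- multiset of [k] of cardinality r (counted with multiplicity), each once.
multisets : (k r : ℕ) → List (Vec ℕ k)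
multisets zero    zero    = [ [] ]
multisets zero    (suc r) = []
multisets (suc k) r       =
  concatMap (λ a → map (a ∷_) (multisets k (r ∸ a))) (upTo (suc r))

tuples : ∀ {m} (k : ℕ) → Vec ℕ m → List (Vec (Vec ℕ k) m)
tuples k []       = [ [] ]
tuples k (r ∷ rs) = concatMap (λ M → map (M ∷_) (tuples k rs)) (multisets k r)

isPos : ℕ → Bool
isPos zero    = false
isPos (suc _) = true

anyV : ∀ {m} {A : Set} → (A → Bool) → Vec A m → Bool
anyV p []       = false
anyV p (a ∷ as) = p a ∨ anyV p as

allL : {A : Set} → (A → Bool) → List A → Bool
allL p = foldr (λ a b → p a ∧ b) true

covers : ∀ {m k} → Vec (Vec ℕ k) m → Bool
covers {k = k} Ms = allL (λ j → anyV (λ M → isPos (lookup M j)) Ms) (allFin k)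

count : {A : Set} → (A → Bool) → List A → ℕ
count p = foldr (λ a n → if p a then suc n else n) 0

ctilde : ∀ {m} → Vec ℕ m → ℕ → ℕ
ctilde rs k = count covers (tuples k rs)

-- binom(r-1, k'-1) with the stated conventions (binom(-1,-1) = 1,
-- negative lower index gives 0, b > a ≥ 0 gives 0, and
-- binom(-1, b) = 0 for b ≥ 0: it counts multisets of size r with
-- support of size exactly k')
B : ℕ → ℕ → ℕ
B zero    zero     = 1
B zero    (suc _)  = 0
B (suc r) zero     = 0
B (suc r) (suc k′) = r C k′

multinom : (k l k₁ k₂ : ℕ) → ℕ
multinom k l k₁ k₂ =
  if (l ≤ᵇ k₁) ∧ (l ≤ᵇ k₂)
  then (k ! / (l ! ℕ.* (k₁ ∸ l) ! ℕ.* (k₂ ∸ l) !))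
         {{m*n≢0 _ _ {{l !* (k₁ ∸ l) !≢0}} {{(k₂ ∸ l) !≢0}}}}
  else 0

sumℕ : List ℕ → ℕ
sumℕ = foldr ℕ._+_ 0

eqInd : (k l k₁ k₂ : ℕ) → ℕ
eqInd k l k₁ k₂ = if (k₁ ℕ.+ k₂) ℕ.≡ᵇ (k ℕ.+ l) then 1 else 0

-- Σ over l, k1, k2 ≥ 0 with k1 + k2 - l = k.  Terms vanish unless
-- k1 ≤ r1, k2 ≤ r2 (via B) and l ≤ k1 (via multinom), so the ranges
-- l, k1 ∈ [0, r1], k2 ∈ [0, r2] contain every nonzero term.
formula2 : (r₁ r₂ k : ℕ) → ℕ
formula2 r₁ r₂ k =
  sumℕ (map (λ l →
  sumℕ (map (λ k₁ →
  sumℕ (map (λ k₂ →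
    eqInd k l k₁ k₂ ℕ.* (multinom k l k₁ k₂ ℕ.* (B r₁ k₁ ℕ.* B r₂ k₂)))
    (upTo (suc r₂))))
    (upTo (suc r₁))))
    (upTo (suc r₁)))

-- Both identities go through the binomial transform a ↦ (n ↦ Σₖ C(n,k) aₖ), which is
-- injective because its matrix is unitriangular.
--
-- At x = n ∈ ℕ the product ((n r₁))⋯((n rₘ)) counts the tuples (M₁,…,Mₘ) of multisets on
-- [n]; grouping them by the set of elements they cover gives Σₖ C(n,k) c̃ₖ(r). Formally this
-- is an induction on n: a tuple on [n+1] is its first column together with a tuple on [n].
-- Both sides of the expansion are polynomials of degree ≤ N written in the basis C(x,k), so
-- agreeing at x = 0,…,N they agree everywhere.
--
-- For m = 2 the transform of c̃ₖ(r₁,r₂) is ((n r₁))((n r₂)). Expanding each factor by the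
-- case m = 1, ((n r)) = Σₖ C(r−1,k−1) C(n,k), leaves products C(n,k₁) C(n,k₂), and counting
-- pairs of subsets A, B of [n] by k = |A ∪ B| and l = |A ∩ B| (Vandermonde) shows that this
-- is also the transform of the stated sum.

module Submission where

open import Algebra.Bundles using (Semiring; CommutativeRing)
open import Algebra.Definitions using (LeftCancellative)
open import Data.Nat.Base using (ℕ; zero; suc; z≤n; s≤s; _≤_; _<_)
import Data.Nat.Base as ℕ
open import Data.Nat.Induction using (<-rec)
import Data.Nat.Properties as ℕ
open import Function.Base using (_∘_)
open import Relation.Binary.PropositionalEquality as ≡ using (_≡_; _≢_)

module RangeSum {c ℓ} (R : Semiring c ℓ) where

  open Semiring R hiding (zero)
  open import Algebra.Properties.CommutativeSemigroup +-commutativeSemigroup using (interchange)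
  open import Relation.Binary.Reasoning.Setoid setoid

  infix 5 Σ≤
  Σ≤ : ℕ → (ℕ → Carrier) → Carrier
  Σ≤ zero    f = f 0
  Σ≤ (suc n) f = f 0 + Σ≤ n (f ∘ suc)

  syntax Σ≤ n (λ k → e) = ∑[ k ≤ n ] e

  Σ≤-cong : ∀ n {f g} → (∀ k → k ≤ n → f k ≈ g k) → Σ≤ n f ≈ Σ≤ n g
  Σ≤-cong zero    eq = eq 0 z≤n
  Σ≤-cong (suc n) eq = +-cong (eq 0 z≤n) (Σ≤-cong n (λ k k≤n → eq (suc k) (s≤s k≤n)))

  Σ≤-zero : ∀ n {f} → (∀ k → k ≤ n → f k ≈ 0#) → Σ≤ n f ≈ 0#
  Σ≤-zero zero    eq = eq 0 z≤n
  Σ≤-zero (suc n) eq = trans (+-cong (eq 0 z≤n) (Σ≤-zero n (λ k k≤n → eq (suc k) (s≤s k≤n)))) (+-identityˡ 0#)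

  Σ≤-distrib-+ : ∀ n (f g : ℕ → Carrier) → ∑[ k ≤ n ] (f k + g k) ≈ Σ≤ n f + Σ≤ n g
  Σ≤-distrib-+ zero    f g = refl
  Σ≤-distrib-+ (suc n) f g =
    trans (+-congˡ (Σ≤-distrib-+ n (f ∘ suc) (g ∘ suc))) (interchange (f 0) (g 0) _ _)

  *-distribˡ-Σ≤ : ∀ n x (f : ℕ → Carrier) → x * Σ≤ n f ≈ ∑[ k ≤ n ] x * f k
  *-distribˡ-Σ≤ zero    x f = refl
  *-distribˡ-Σ≤ (suc n) x f = trans (distribˡ x (f 0) _) (+-congˡ (*-distribˡ-Σ≤ n x (f ∘ suc)))

  *-distribʳ-Σ≤ : ∀ n x (f : ℕ → Carrier) → Σ≤ n f * x ≈ ∑[ k ≤ n ] f k * x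
  *-distribʳ-Σ≤ zero    x f = refl
  *-distribʳ-Σ≤ (suc n) x f = trans (distribʳ x (f 0) _) (+-congˡ (*-distribʳ-Σ≤ n x (f ∘ suc)))

  Σ≤-comm : ∀ m n (f : ℕ → ℕ → Carrier) → ∑[ i ≤ m ] ∑[ j ≤ n ] f i j ≈ ∑[ j ≤ n ] ∑[ i ≤ m ] f i j
  Σ≤-comm zero    n f = refl
  Σ≤-comm (suc m) n f = begin
    Σ≤ n (f 0) + (∑[ i ≤ m ] ∑[ j ≤ n ] f (suc i) j)  ≈⟨ +-congˡ (Σ≤-comm m n (f ∘ suc)) ⟩
    Σ≤ n (f 0) + (∑[ j ≤ n ] ∑[ i ≤ m ] f (suc i) j)  ≈⟨ Σ≤-distrib-+ n (f 0) _ ⟨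
    ∑[ j ≤ n ] (f 0 j + (∑[ i ≤ m ] f (suc i) j))     ∎

  Σ≤-sink : ∀ m a b (f : ℕ → ℕ → ℕ → Carrier) →
    ∑[ i ≤ m ] ∑[ j ≤ a ] ∑[ k ≤ b ] f i j k ≈ ∑[ j ≤ a ] ∑[ k ≤ b ] ∑[ i ≤ m ] f i j k
  Σ≤-sink m a b f = trans (Σ≤-comm m a _) (Σ≤-cong a (λ j _ → Σ≤-comm m b (λ i k → f i j k)))

  Σ≤-*-Σ≤ : ∀ m n (f g : ℕ → Carrier) → Σ≤ m f * Σ≤ n g ≈ ∑[ i ≤ m ] ∑[ j ≤ n ] f i * g j
  Σ≤-*-Σ≤ m n f g = trans (*-distribʳ-Σ≤ m (Σ≤ n g) f) (Σ≤-cong m (λ i _ → *-distribˡ-Σ≤ n (f i) g))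

  Σ≤-last : ∀ n (f : ℕ → Carrier) → Σ≤ (suc n) f ≈ Σ≤ n f + f (suc n)
  Σ≤-last zero    f = refl
  Σ≤-last (suc n) f = trans (+-congˡ (Σ≤-last n (f ∘ suc))) (sym (+-assoc (f 0) _ _))

  Σ≤-extend : ∀ {m n} f → n ≤ m → (∀ k → n < k → f k ≈ 0#) → Σ≤ m f ≈ Σ≤ n f
  Σ≤-extend {zero}  {zero}  f _         _    = refl
  Σ≤-extend {suc m} {zero}  f _         tail =
    trans (+-congˡ (Σ≤-zero m (λ k _ → tail (suc k) (s≤s z≤n)))) (+-identityʳ (f 0))
  Σ≤-extend {suc m} {suc n} f (s≤s n≤m) tail =
    +-congˡ (Σ≤-extend (f ∘ suc) n≤m (λ k n<k → tail (suc k) (s≤s n<k)))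

  Σ≤-point : ∀ {n K} f → K ≤ n → (∀ k → k ≢ K → f k ≈ 0#) → Σ≤ n f ≈ f K
  Σ≤-point {zero}  {zero}  f _         _   = refl
  Σ≤-point {suc n} {zero}  f _         off =
    trans (+-congˡ (Σ≤-zero n (λ k _ → off (suc k) λ ()))) (+-identityʳ (f 0))
  Σ≤-point {suc n} {suc K} f (s≤s K≤n) off = trans (+-congʳ (off 0 λ ())) (trans (+-identityˡ _)
    (Σ≤-point (f ∘ suc) K≤n (λ k k≢K → off (suc k) (k≢K ∘ ℕ.suc-injective))))

  unitriangular-injective : LeftCancellative _≈_ _+_ → (M : ℕ → ℕ → Carrier) → (∀ j → M j j ≈ 1#) →
    ∀ {c e : ℕ → Carrier} N → (∀ j → j ≤ N → ∑[ k ≤ j ] M j k * c k ≈ ∑[ k ≤ j ] M j k * e k) →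
    ∀ j → j ≤ N → c j ≈ e j
  unitriangular-injective cancel M diag {c} {e} N eqs = <-rec _ step
    where
    cancel-diag : ∀ j → M j j * c j ≈ M j j * e j → c j ≈ e j
    cancel-diag j eq = begin
      c j          ≈⟨ *-identityˡ (c j) ⟨
      1# * c j     ≈⟨ *-congʳ (diag j) ⟨
      M j j * c j  ≈⟨ eq ⟩
      M j j * e j  ≈⟨ *-congʳ (diag j) ⟩
      1# * e j     ≈⟨ *-identityˡ (e j) ⟩
      e j          ∎
    step : ∀ j → (∀ {i} → i < j → i ≤ N → c i ≈ e i) → j ≤ N → c j ≈ e j
    step zero    _     0≤N = cancel-diag 0 (eqs 0 0≤N)
    step (suc j) below j<N = cancel-diag (suc j) (cancel _ _ _ (begin
      Σ≤ j (λ k → M (suc j) k * c k) + M (suc j) (suc j) * c (suc j)  ≈⟨ Σ≤-last j _ ⟨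
      Σ≤ (suc j) (λ k → M (suc j) k * c k)                            ≈⟨ eqs (suc j) j<N ⟩
      Σ≤ (suc j) (λ k → M (suc j) k * e k)                            ≈⟨ Σ≤-last j _ ⟩
      Σ≤ j (λ k → M (suc j) k * e k) + M (suc j) (suc j) * e (suc j)  ≈⟨ +-congʳ (Σ≤-cong j previous) ⟨
      Σ≤ j (λ k → M (suc j) k * c k) + M (suc j) (suc j) * e (suc j)  ∎))
      where
      previous : ∀ k → k ≤ j → M (suc j) k * c k ≈ M (suc j) k * e k
      previous k k≤j = *-congˡ (below (s≤s k≤j) (ℕ.≤-trans (ℕ.m≤n⇒m≤1+n k≤j) j<N))

open import Data.Bool.Base using (Bool; true; false; if_then_else_; _∧_; _∨_)
open import Data.Bool.Properties using (T-≡; ∧-zeroʳ)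
open import Data.Fin.Base as Fin using (Fin)
import Data.Integer.Base as ℤ
import Data.Integer.Properties as ℤ
open import Data.List.Base using (List; []; _∷_)
import Data.List.Base as List
import Data.List.Properties as List
open import Data.Nat.Combinatorics using (_C_; nCk+nC[k+1]≡[n+1]C[k+1]; k>n⇒nCk≡0; nCn≡1; nCk≡n!/k![n-k]!; k![n∸k]!∣n!)
open import Data.Nat.Coprimality using (1-coprimeTo)
import Data.Nat.Coprimality as Coprime
open import Data.Nat.ListAction using (sum)
open import Data.Nat.ListAction.Properties using (sum-++)
open import Data.Nat.Properties using (_!≢0; _!*_!≢0; _≤?_)
import Data.Rational.Properties as ℚ
open import Data.Sum.Base using (_⊎_; inj₁; inj₂)
open import Data.Vec.Base as Vec using (Vec; []; _∷_; lookup)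
open import Function.Bundles using (Equivalence)
open import Relation.Nullary using (Dec; yes; no; contradiction)
open import Relation.Nullary.Reflects using (ofʸ)
open ≡ using (refl; cong; cong₂; sym; trans)

open import Defs

module ℕΣ = RangeSum ℕ.+-*-semiring
module ℚΣ = RangeSum (CommutativeRing.semiring ℚ.+-*-commutativeRing)

module _ where
  open ℕΣ
  open import Data.Nat.Base using (_+_; _*_; _∸_; _!; _≤ᵇ_; _≡ᵇ_)
  open import Data.List.Base using ([_]; _++_; map; concatMap; applyUpTo; upTo; tabulate; allFin; length)
  open import Data.Nat.DivMod using (_/_; m/n*n≡m; m*n/n≡m; /-congˡ; /-congʳ)
  open import Data.Nat.Solver using (module +-*-Solver)
  open import Algebra.Properties.CommutativeSemigroup ℕ.+-commutativeSemigroup using (interchange; x∙yz≈y∙xz)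

  open +-*-Solver

  private variable
    X Y Z : Set

  infix 5 ∑ₗ
  ∑ₗ : (X → ℕ) → List X → ℕ
  ∑ₗ f xs = sum (map f xs)

  syntax ∑ₗ (λ x → e) xs = ∑ₗ[ x ∈ xs ] e

  ∑ₗ-cong : ∀ {f g : X → ℕ} → (∀ x → f x ≡ g x) → ∀ xs → ∑ₗ f xs ≡ ∑ₗ g xs
  ∑ₗ-cong eq xs = cong sum (List.map-cong eq xs)

  ∑ₗ-++ : ∀ (f : X → ℕ) xs ys → ∑ₗ f (xs ++ ys) ≡ ∑ₗ f xs + ∑ₗ f ys
  ∑ₗ-++ f xs ys = trans (cong sum (List.map-++ f xs ys)) (sum-++ (map f xs) (map f ys))

  ∑ₗ-concatMap-map : ∀ (f : Z → ℕ) (g : X → Y → Z) (h : X → List Y) xs →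
    ∑ₗ f (concatMap (λ x → map (g x) (h x)) xs) ≡ ∑ₗ[ x ∈ xs ] ∑ₗ[ y ∈ h x ] f (g x y)
  ∑ₗ-concatMap-map f g h []       = refl
  ∑ₗ-concatMap-map f g h (x ∷ xs) = trans (∑ₗ-++ f (map (g x) (h x)) _)
    (cong₂ _+_ (cong sum (sym (List.map-∘ (h x)))) (∑ₗ-concatMap-map f g h xs))

  ∑ₗ-applyUpTo : ∀ (f : ℕ → ℕ) g n → ∑ₗ f (applyUpTo g (suc n)) ≡ ∑[ k ≤ n ] f (g k)
  ∑ₗ-applyUpTo f g zero    = ℕ.+-identityʳ (f (g 0))
  ∑ₗ-applyUpTo f g (suc n) = cong (f (g 0) +_) (∑ₗ-applyUpTo f (g ∘ suc) n)

  ∑ₗ-upTo : ∀ (f : ℕ → ℕ) n → ∑ₗ f (upTo (suc n)) ≡ Σ≤ n f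
  ∑ₗ-upTo f = ∑ₗ-applyUpTo f (λ k → k)

  ∑ₗ-const : ∀ c (xs : List X) → ∑ₗ (λ _ → c) xs ≡ length xs * c
  ∑ₗ-const c []       = refl
  ∑ₗ-const c (x ∷ xs) = cong (c +_) (∑ₗ-const c xs)

  length≡∑ₗ1 : ∀ (xs : List X) → length xs ≡ ∑ₗ (λ _ → 1) xs
  length≡∑ₗ1 xs = trans (sym (ℕ.*-identityʳ (length xs))) (sym (∑ₗ-const 1 xs))

  ∑ₗ-zero : ∀ (xs : List X) → ∑ₗ (λ _ → 0) xs ≡ 0
  ∑ₗ-zero xs = trans (∑ₗ-const 0 xs) (ℕ.*-zeroʳ (length xs))

  ∑ₗ-distrib-+ : ∀ (f g : X → ℕ) xs → ∑ₗ[ x ∈ xs ] (f x + g x) ≡ ∑ₗ f xs + ∑ₗ g xs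
  ∑ₗ-distrib-+ f g []       = refl
  ∑ₗ-distrib-+ f g (x ∷ xs) = trans (cong (f x + g x +_) (∑ₗ-distrib-+ f g xs)) (interchange (f x) (g x) _ _)

  *-distribˡ-∑ₗ : ∀ c (f : X → ℕ) xs → c * ∑ₗ f xs ≡ ∑ₗ[ x ∈ xs ] c * f x
  *-distribˡ-∑ₗ c f []       = ℕ.*-zeroʳ c
  *-distribˡ-∑ₗ c f (x ∷ xs) = trans (ℕ.*-distribˡ-+ c (f x) _) (cong (c * f x +_) (*-distribˡ-∑ₗ c f xs))

  ∑ₗ-comm : ∀ (f : X → Y → ℕ) xs ys → ∑ₗ[ x ∈ xs ] ∑ₗ[ y ∈ ys ] f x y ≡ ∑ₗ[ y ∈ ys ] ∑ₗ[ x ∈ xs ] f x y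
  ∑ₗ-comm f []       ys = sym (∑ₗ-zero ys)
  ∑ₗ-comm f (x ∷ xs) ys = trans (cong (∑ₗ (f x) ys +_) (∑ₗ-comm f xs ys)) (sym (∑ₗ-distrib-+ (f x) _ ys))

  ∑ₗ-Σ≤-comm : ∀ (f : X → ℕ → ℕ) xs n → ∑ₗ[ x ∈ xs ] Σ≤ n (f x) ≡ ∑[ k ≤ n ] ∑ₗ[ x ∈ xs ] f x k
  ∑ₗ-Σ≤-comm f []       n = sym (Σ≤-zero n (λ _ _ → refl))
  ∑ₗ-Σ≤-comm f (x ∷ xs) n = trans (cong (Σ≤ n (f x) +_) (∑ₗ-Σ≤-comm f xs n)) (sym (Σ≤-distrib-+ n (f x) _))

  indicator : Bool → ℕ
  indicator b = if b then 1 else 0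

  count≡∑ₗ : ∀ (p : X → Bool) xs → count p xs ≡ ∑ₗ[ x ∈ xs ] indicator (p x)
  count≡∑ₗ p []       = refl
  count≡∑ₗ p (x ∷ xs) with p x
  ... | true  = cong suc (count≡∑ₗ p xs)
  ... | false = count≡∑ₗ p xs

  count-true : ∀ (xs : List X) → count (λ _ → true) xs ≡ length xs
  count-true []       = refl
  count-true (x ∷ xs) = cong suc (count-true xs)

  -- Tuples of multisets, column by column

  -- A tuple of multisets on [k+1] is determined by its first column a (a i is the
  -- multiplicity of the first element in M i) and by a tuple on [k] of sizes rs ∸ᵛ a.
  columns : ∀ {m} → Vec ℕ m → List (Vec ℕ m)
  columns []       = [ [] ]
  columns (r ∷ rs) = concatMap (λ a → map (a ∷_) (columns rs)) (upTo (suc r))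

  infixl 6 _∸ᵛ_
  _∸ᵛ_ : ∀ {m} → Vec ℕ m → Vec ℕ m → Vec ℕ m
  _∸ᵛ_ = Vec.zipWith _∸_

  consColumn : ∀ {m k} → Vec ℕ m → Vec (Vec ℕ k) m → Vec (Vec ℕ (suc k)) m
  consColumn = Vec.zipWith _∷_

  ∑ₗ-tuples-suc : ∀ {m} k (rs : Vec ℕ m) (f : Vec (Vec ℕ (suc k)) m → ℕ) →
    ∑ₗ f (tuples (suc k) rs) ≡ ∑ₗ[ a ∈ columns rs ] ∑ₗ[ Ms ∈ tuples k (rs ∸ᵛ a) ] f (consColumn a Ms)
  ∑ₗ-tuples-suc k []       f = sym (ℕ.+-identityʳ (f [] + 0))
  ∑ₗ-tuples-suc k (r ∷ rs) f = begin
    ∑ₗ f (tuples (suc k) (r ∷ rs))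
      ≡⟨ ∑ₗ-concatMap-map f _∷_ (λ _ → tuples (suc k) rs) (multisets (suc k) r) ⟩
    ∑ₗ[ M ∈ multisets (suc k) r ] ∑ₗ[ Ms ∈ tuples (suc k) rs ] f (M ∷ Ms)
      ≡⟨ ∑ₗ-concatMap-map _ _∷_ (λ a → multisets k (r ∸ a)) (upTo (suc r)) ⟩
    ∑ₗ[ a ∈ upTo (suc r) ] ∑ₗ[ M ∈ multisets k (r ∸ a) ] ∑ₗ[ Ms ∈ tuples (suc k) rs ] f ((a ∷ M) ∷ Ms)
      ≡⟨ ∑ₗ-cong (λ a → ∑ₗ-cong (λ M → ∑ₗ-tuples-suc k rs (λ Ms → f ((a ∷ M) ∷ Ms))) (multisets k (r ∸ a))) (upTo (suc r)) ⟩
    ∑ₗ[ a ∈ upTo (suc r) ] ∑ₗ[ M ∈ multisets k (r ∸ a) ] ∑ₗ[ b ∈ columns rs ]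
      ∑ₗ[ Ms ∈ tuples k (rs ∸ᵛ b) ] f ((a ∷ M) ∷ consColumn b Ms)
      ≡⟨ ∑ₗ-cong (λ a → ∑ₗ-comm _ (multisets k (r ∸ a)) (columns rs)) (upTo (suc r)) ⟩
    ∑ₗ[ a ∈ upTo (suc r) ] ∑ₗ[ b ∈ columns rs ] ∑ₗ[ M ∈ multisets k (r ∸ a) ]
      ∑ₗ[ Ms ∈ tuples k (rs ∸ᵛ b) ] f ((a ∷ M) ∷ consColumn b Ms)
      ≡⟨ ∑ₗ-cong (λ a → ∑ₗ-cong (λ b →
           ∑ₗ-concatMap-map _ _∷_ (λ _ → tuples k (rs ∸ᵛ b)) (multisets k (r ∸ a))) (columns rs)) (upTo (suc r)) ⟨
    ∑ₗ[ a ∈ upTo (suc r) ] ∑ₗ[ b ∈ columns rs ] ∑ₗ[ Ms ∈ tuples k ((r ∷ rs) ∸ᵛ (a ∷ b)) ] f (consColumn (a ∷ b) Ms)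
      ≡⟨ ∑ₗ-concatMap-map _ _∷_ (λ _ → columns rs) (upTo (suc r)) ⟨
    ∑ₗ[ a ∈ columns (r ∷ rs) ] ∑ₗ[ Ms ∈ tuples k ((r ∷ rs) ∸ᵛ a) ] f (consColumn a Ms) ∎
    where open ≡.≡-Reasoning

  occurs : ∀ {m k} → Fin k → Vec (Vec ℕ k) m → Bool
  occurs j = anyV (λ M → isPos (lookup M j))

  occurs-zero : ∀ {m k} (a : Vec ℕ m) (Ms : Vec (Vec ℕ k) m) → occurs Fin.zero (consColumn a Ms) ≡ anyV isPos a
  occurs-zero []      []       = refl
  occurs-zero (x ∷ a) (M ∷ Ms) = cong (isPos x ∨_) (occurs-zero a Ms)

  occurs-suc : ∀ {m k} j (a : Vec ℕ m) (Ms : Vec (Vec ℕ k) m) → occurs (Fin.suc j) (consColumn a Ms) ≡ occurs j Ms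
  occurs-suc j []      []       = refl
  occurs-suc j (x ∷ a) (M ∷ Ms) = cong (isPos (lookup M j) ∨_) (occurs-suc j a Ms)

  allL-tabulate : ∀ {n} {p : X → Bool} {q : Fin n → Bool} (f : Fin n → X) →
    (∀ i → p (f i) ≡ q i) → allL p (tabulate f) ≡ allL q (allFin n)
  allL-tabulate {n = zero}  f eq = refl
  allL-tabulate {n = suc n} {q = q} f eq =
    cong₂ _∧_ (eq Fin.zero) (trans (allL-tabulate (f ∘ Fin.suc) (eq ∘ Fin.suc)) (sym (allL-tabulate {p = q} Fin.suc (λ _ → refl))))

  covers-consColumn : ∀ {m k} (a : Vec ℕ m) (Ms : Vec (Vec ℕ k) m) → covers (consColumn a Ms) ≡ anyV isPos a ∧ covers Ms
  covers-consColumn a Ms = cong₂ _∧_ (occurs-zero a Ms) (allL-tabulate Fin.suc (λ j → occurs-suc j a Ms))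

  ctilde-suc : ∀ {m} (rs : Vec ℕ m) k →
    ctilde rs (suc k) ≡ ∑ₗ[ a ∈ columns rs ] (if anyV isPos a then ctilde (rs ∸ᵛ a) k else 0)
  ctilde-suc rs k = begin
    ctilde rs (suc k)
      ≡⟨ count≡∑ₗ covers (tuples (suc k) rs) ⟩
    ∑ₗ[ Ms ∈ tuples (suc k) rs ] indicator (covers Ms)
      ≡⟨ ∑ₗ-tuples-suc k rs (indicator ∘ covers) ⟩
    ∑ₗ[ a ∈ columns rs ] ∑ₗ[ Ms ∈ tuples k (rs ∸ᵛ a) ] indicator (covers (consColumn a Ms))
      ≡⟨ ∑ₗ-cong column (columns rs) ⟩
    ∑ₗ[ a ∈ columns rs ] (if anyV isPos a then ctilde (rs ∸ᵛ a) k else 0) ∎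
    where
    open ≡.≡-Reasoning
    split : ∀ a b → ∑ₗ[ Ms ∈ tuples k (rs ∸ᵛ a) ] indicator (b ∧ covers Ms) ≡ (if b then ctilde (rs ∸ᵛ a) k else 0)
    split a true  = sym (count≡∑ₗ covers (tuples k (rs ∸ᵛ a)))
    split a false = ∑ₗ-zero (tuples k (rs ∸ᵛ a))
    column : ∀ a → ∑ₗ[ Ms ∈ tuples k (rs ∸ᵛ a) ] indicator (covers (consColumn a Ms))
                 ≡ (if anyV isPos a then ctilde (rs ∸ᵛ a) k else 0)
    column a = trans (∑ₗ-cong (λ Ms → cong indicator (covers-consColumn a Ms)) (tuples k (rs ∸ᵛ a))) (split a (anyV isPos a))

  ∑ₗ-columns-split : ∀ {m} (rs : Vec ℕ m) (g : Vec ℕ m → ℕ) →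
    ∑ₗ[ a ∈ columns rs ] g (rs ∸ᵛ a) ≡ g rs + (∑ₗ[ a ∈ columns rs ] (if anyV isPos a then g (rs ∸ᵛ a) else 0))
  ∑ₗ-columns-split []       g = refl
  ∑ₗ-columns-split (r ∷ rs) g = begin
    ∑ₗ[ a ∈ columns (r ∷ rs) ] g ((r ∷ rs) ∸ᵛ a)
      ≡⟨ ∑ₗ-concatMap-map _ _∷_ (λ _ → columns rs) (upTo (suc r)) ⟩
    ∑ₗ (h 0) (columns rs) + later h
      ≡⟨ cong (_+ later h) (∑ₗ-columns-split rs (g ∘ (r ∷_))) ⟩
    g (r ∷ rs) + ∑ₗ (h′ 0) (columns rs) + later h
      ≡⟨ ℕ.+-assoc (g (r ∷ rs)) _ _ ⟩
    g (r ∷ rs) + (∑ₗ (h′ 0) (columns rs) + later h)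
      ≡⟨ cong (λ t → g (r ∷ rs) + (∑ₗ (h′ 0) (columns rs) + t)) later-columns ⟩
    g (r ∷ rs) + (∑ₗ (h′ 0) (columns rs) + later h′)
      ≡⟨ cong (g (r ∷ rs) +_) (∑ₗ-concatMap-map _ _∷_ (λ _ → columns rs) (upTo (suc r))) ⟨
    g (r ∷ rs) + (∑ₗ[ a ∈ columns (r ∷ rs) ] (if anyV isPos a then g ((r ∷ rs) ∸ᵛ a) else 0)) ∎
    where
    open ≡.≡-Reasoning
    h h′ : ℕ → Vec ℕ _ → ℕ
    h  a b = g ((r ∷ rs) ∸ᵛ (a ∷ b))
    h′ a b = if anyV isPos (a ∷ b) then h a b else 0
    later : (ℕ → Vec ℕ _ → ℕ) → ℕ
    later f = ∑ₗ[ a ∈ applyUpTo suc r ] ∑ₗ (f a) (columns rs)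
    -- a column whose first entry is positive is nonzero, so h and h′ agree on it
    later-columns : later h ≡ later h′
    later-columns = cong sum (trans (List.map-applyUpTo suc _ r) (sym (List.map-applyUpTo suc _ r)))

  ∑ₗ-ctilde-columns : ∀ {m} (rs : Vec ℕ m) k → ∑ₗ[ a ∈ columns rs ] ctilde (rs ∸ᵛ a) k ≡ ctilde rs k + ctilde rs (suc k)
  ∑ₗ-ctilde-columns rs k = trans (∑ₗ-columns-split rs (λ v → ctilde v k)) (cong (ctilde rs k +_) (sym (ctilde-suc rs k)))

  #tuples : ∀ {m} → Vec ℕ m → ℕ → ℕ
  #tuples rs n = length (tuples n rs)

  #multisets : ℕ → ℕ → ℕ
  #multisets n r = length (multisets n r)

  #tuples-suc : ∀ {m} (rs : Vec ℕ m) n → #tuples rs (suc n) ≡ ∑ₗ[ a ∈ columns rs ] #tuples (rs ∸ᵛ a) n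
  #tuples-suc rs n = begin
    #tuples rs (suc n)                                       ≡⟨ length≡∑ₗ1 (tuples (suc n) rs) ⟩
    ∑ₗ (λ _ → 1) (tuples (suc n) rs)                         ≡⟨ ∑ₗ-tuples-suc n rs (λ _ → 1) ⟩
    ∑ₗ[ a ∈ columns rs ] ∑ₗ (λ _ → 1) (tuples n (rs ∸ᵛ a))   ≡⟨ ∑ₗ-cong (λ a → sym (length≡∑ₗ1 (tuples n (rs ∸ᵛ a)))) (columns rs) ⟩
    ∑ₗ[ a ∈ columns rs ] #tuples (rs ∸ᵛ a) n                 ∎
    where open ≡.≡-Reasoning

  Σ≤-pascal : ∀ n (g : ℕ → ℕ) → ∑[ k ≤ suc n ] (suc n C k) * g k ≡ ∑[ k ≤ n ] (n C k) * (g k + g (suc k))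
  Σ≤-pascal n g = begin
    ∑[ k ≤ suc n ] (suc n C k) * g k
      ≡⟨ cong₂ _+_ (ℕ.*-identityˡ (g 0)) (Σ≤-cong n (λ k _ → cong (_* g (suc k)) (sym (nCk+nC[k+1]≡[n+1]C[k+1] n k)))) ⟩
    g 0 + (∑[ k ≤ n ] (n C k + n C suc k) * g (suc k))
      ≡⟨ cong (g 0 +_) (trans (Σ≤-cong n (λ k _ → ℕ.*-distribʳ-+ (g (suc k)) (n C k) _)) (Σ≤-distrib-+ n _ _)) ⟩
    g 0 + (shifted + lowered)
      ≡⟨ x∙yz≈y∙xz (g 0) shifted lowered ⟩
    shifted + (g 0 + lowered)
      ≡⟨ cong (shifted +_) unshift ⟩
    shifted + (∑[ k ≤ n ] (n C k) * g k)
      ≡⟨ ℕ.+-comm shifted _ ⟩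
    (∑[ k ≤ n ] (n C k) * g k) + shifted
      ≡⟨ Σ≤-distrib-+ n _ _ ⟨
    ∑[ k ≤ n ] ((n C k) * g k + (n C k) * g (suc k))
      ≡⟨ Σ≤-cong n (λ k _ → ℕ.*-distribˡ-+ (n C k) (g k) (g (suc k))) ⟨
    ∑[ k ≤ n ] (n C k) * (g k + g (suc k)) ∎
    where
    open ≡.≡-Reasoning
    shifted lowered : ℕ
    shifted = ∑[ k ≤ n ] (n C k) * g (suc k)
    lowered = ∑[ k ≤ n ] (n C suc k) * g (suc k)
    unshift : g 0 + lowered ≡ ∑[ k ≤ n ] (n C k) * g k
    unshift = trans (cong (_+ lowered) (sym (ℕ.*-identityˡ (g 0))))
      (Σ≤-extend (λ k → (n C k) * g k) (ℕ.n≤1+n n) (λ k n<k → cong (_* g k) (k>n⇒nCk≡0 n<k)))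

  #tuples-binomial : ∀ {m} (rs : Vec ℕ m) n → #tuples rs n ≡ ∑[ k ≤ n ] (n C k) * ctilde rs k
  #tuples-binomial rs zero    = sym (trans (ℕ.+-identityʳ (ctilde rs 0)) (count-true (tuples 0 rs)))
  #tuples-binomial rs (suc n) = begin
    #tuples rs (suc n)
      ≡⟨ #tuples-suc rs n ⟩
    ∑ₗ[ a ∈ columns rs ] #tuples (rs ∸ᵛ a) n
      ≡⟨ ∑ₗ-cong (λ a → #tuples-binomial (rs ∸ᵛ a) n) (columns rs) ⟩
    ∑ₗ[ a ∈ columns rs ] ∑[ k ≤ n ] (n C k) * ctilde (rs ∸ᵛ a) k
      ≡⟨ ∑ₗ-Σ≤-comm _ (columns rs) n ⟩
    ∑[ k ≤ n ] ∑ₗ[ a ∈ columns rs ] (n C k) * ctilde (rs ∸ᵛ a) k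
      ≡⟨ Σ≤-cong n (λ k _ → *-distribˡ-∑ₗ (n C k) _ (columns rs)) ⟨
    ∑[ k ≤ n ] (n C k) * (∑ₗ[ a ∈ columns rs ] ctilde (rs ∸ᵛ a) k)
      ≡⟨ Σ≤-cong n (λ k _ → cong ((n C k) *_) (∑ₗ-ctilde-columns rs k)) ⟩
    ∑[ k ≤ n ] (n C k) * (ctilde rs k + ctilde rs (suc k))
      ≡⟨ Σ≤-pascal n (ctilde rs) ⟨
    ∑[ k ≤ suc n ] (suc n C k) * ctilde rs k ∎
    where open ≡.≡-Reasoning

  #tuples-∷ : ∀ {m} r (rs : Vec ℕ m) n → #tuples (r ∷ rs) n ≡ #multisets n r * #tuples rs n
  #tuples-∷ r rs n = begin
    #tuples (r ∷ rs) n
      ≡⟨ length≡∑ₗ1 (tuples n (r ∷ rs)) ⟩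
    ∑ₗ (λ _ → 1) (tuples n (r ∷ rs))
      ≡⟨ ∑ₗ-concatMap-map (λ _ → 1) _∷_ (λ _ → tuples n rs) (multisets n r) ⟩
    ∑ₗ[ M ∈ multisets n r ] ∑ₗ (λ _ → 1) (tuples n rs)
      ≡⟨ ∑ₗ-const _ (multisets n r) ⟩
    #multisets n r * ∑ₗ (λ _ → 1) (tuples n rs)
      ≡⟨ cong (#multisets n r *_) (length≡∑ₗ1 (tuples n rs)) ⟨
    #multisets n r * #tuples rs n ∎
    where open ≡.≡-Reasoning

  #multisets-suc : ∀ n r → #multisets (suc n) r ≡ ∑[ a ≤ r ] #multisets n (r ∸ a)
  #multisets-suc n r = begin
    #multisets (suc n) r
      ≡⟨ length≡∑ₗ1 (multisets (suc n) r) ⟩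
    ∑ₗ (λ _ → 1) (multisets (suc n) r)
      ≡⟨ ∑ₗ-concatMap-map (λ _ → 1) _∷_ (λ a → multisets n (r ∸ a)) (upTo (suc r)) ⟩
    ∑ₗ[ a ∈ upTo (suc r) ] ∑ₗ (λ _ → 1) (multisets n (r ∸ a))
      ≡⟨ ∑ₗ-cong (λ a → sym (length≡∑ₗ1 (multisets n (r ∸ a)))) (upTo (suc r)) ⟩
    ∑ₗ[ a ∈ upTo (suc r) ] #multisets n (r ∸ a)
      ≡⟨ ∑ₗ-upTo (λ a → #multisets n (r ∸ a)) r ⟩
    ∑[ a ≤ r ] #multisets n (r ∸ a) ∎
    where open ≡.≡-Reasoning

  #multisets-zero : ∀ n → #multisets n 0 ≡ 1
  #multisets-zero zero    = refl
  #multisets-zero (suc n) = trans (#multisets-suc n 0) (#multisets-zero n)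

  #multisets-pascal : ∀ n r → #multisets (suc n) (suc r) ≡ #multisets (suc n) r + #multisets n (suc r)
  #multisets-pascal n r = begin
    #multisets (suc n) (suc r)                        ≡⟨ #multisets-suc n (suc r) ⟩
    #multisets n (suc r) + (∑[ a ≤ r ] #multisets n (r ∸ a)) ≡⟨ cong (#multisets n (suc r) +_) (#multisets-suc n r) ⟨
    #multisets n (suc r) + #multisets (suc n) r       ≡⟨ ℕ.+-comm (#multisets n (suc r)) _ ⟩
    #multisets (suc n) r + #multisets n (suc r)       ∎
    where open ≡.≡-Reasoning

  -- Binomial identities

  vandermonde : ∀ a b k → ∑[ l ≤ k ] (a C l) * (b C (k ∸ l)) ≡ (a + b) C k
  vandermonde zero    b zero    = refl
  vandermonde zero    b (suc k) =
    trans (cong₂ _+_ (ℕ.*-identityˡ (b C suc k)) (Σ≤-zero k (λ _ _ → refl))) (ℕ.+-identityʳ (b C suc k))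
  vandermonde (suc a) b zero    = refl
  vandermonde (suc a) b (suc k) = begin
    ∑[ l ≤ suc k ] (suc a C l) * (b C (suc k ∸ l))
      ≡⟨ cong₂ _+_ (ℕ.*-identityˡ (b C suc k))
           (Σ≤-cong k (λ l _ → cong (_* (b C (k ∸ l))) (sym (nCk+nC[k+1]≡[n+1]C[k+1] a l)))) ⟩
    b C suc k + (∑[ l ≤ k ] (a C l + a C suc l) * (b C (k ∸ l)))
      ≡⟨ cong (b C suc k +_) (trans (Σ≤-cong k (λ l _ → ℕ.*-distribʳ-+ (b C (k ∸ l)) (a C l) _)) (Σ≤-distrib-+ k _ _)) ⟩
    b C suc k + (low + high)
      ≡⟨ x∙yz≈y∙xz (b C suc k) low high ⟩
    low + (b C suc k + high)
      ≡⟨ cong₂ _+_ (vandermonde a b k) (trans (cong (_+ high) (sym (ℕ.*-identityˡ (b C suc k)))) (vandermonde a b (suc k))) ⟩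
    (a + b) C k + (a + b) C suc k
      ≡⟨ nCk+nC[k+1]≡[n+1]C[k+1] (a + b) k ⟩
    suc (a + b) C suc k ∎
    where
    open ≡.≡-Reasoning
    low high : ℕ
    low  = ∑[ l ≤ k ] (a C l) * (b C (k ∸ l))
    high = ∑[ l ≤ k ] (a C suc l) * (b C (k ∸ l))

  hockey-stick : ∀ r k → ∑[ a ≤ r ] B (r ∸ a) k ≡ r C k
  hockey-stick zero    zero    = refl
  hockey-stick zero    (suc k) = refl
  hockey-stick (suc r) zero    = hockey-stick r zero
  hockey-stick (suc r) (suc k) = trans (cong (r C k +_) (hockey-stick r (suc k))) (nCk+nC[k+1]≡[n+1]C[k+1] r k)

  nCk*k!*[n∸k]!≡n! : ∀ {n k} → k ≤ n → (n C k) * (k ! * (n ∸ k) !) ≡ n !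
  nCk*k!*[n∸k]!≡n! {n} {k} k≤n = trans (cong (_* (k ! * (n ∸ k) !)) (nCk≡n!/k![n-k]! k≤n)) (m/n*n≡m (k![n∸k]!∣n! k≤n))
    where instance _ = k !* (n ∸ k) !≢0

  [m+n]Cm*m!*n!≡[m+n]! : ∀ m n → ((m + n) C m) * (m ! * n !) ≡ (m + n) !
  [m+n]Cm*m!*n!≡[m+n]! m n =
    trans (cong (λ d → ((m + n) C m) * (m ! * d !)) (sym (ℕ.m+n∸m≡n m n))) (nCk*k!*[n∸k]!≡n! (ℕ.m≤m+n m n))

  trinomial : ∀ j p q → ((j + p + q) C (j + p)) * ((j + p) C j) * (j ! * p ! * q !) ≡ (j + p + q) !
  trinomial j p q = begin
    ((j + p + q) C (j + p)) * ((j + p) C j) * (j ! * p ! * q !)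
      ≡⟨ solve 5 (λ X Y J P Q → X :* Y :* (J :* P :* Q) := X :* (Y :* (J :* P) :* Q)) refl
           ((j + p + q) C (j + p)) ((j + p) C j) (j !) (p !) (q !) ⟩
    ((j + p + q) C (j + p)) * (((j + p) C j) * (j ! * p !) * q !)
      ≡⟨ cong (λ x → ((j + p + q) C (j + p)) * (x * q !)) ([m+n]Cm*m!*n!≡[m+n]! j p) ⟩
    ((j + p + q) C (j + p)) * ((j + p) ! * q !)
      ≡⟨ [m+n]Cm*m!*n!≡[m+n]! (j + p) q ⟩
    (j + p + q) ! ∎
    where open ≡.≡-Reasoning

  -- Both sides count pairs B ⊆ A ⊆ [n] with |B| = m and |A| = m + b; when m + b ≤ n, both
  -- become n! after multiplying by m! b! (n ∸ (m + b))!.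
  subset-of-subset : ∀ n m b → (n C (m + b)) * ((m + b) C m) ≡ (n C m) * ((n ∸ m) C b)
  subset-of-subset n m b with m + b ≤? n
  ... | yes m+b≤n = split (n ∸ (m + b)) (ℕ.m+[n∸m]≡n m+b≤n)
    where
    split : ∀ q → m + b + q ≡ n → (n C (m + b)) * ((m + b) C m) ≡ (n C m) * ((n ∸ m) C b)
    split q refl = ℕ.*-cancelʳ-≡ _ _ (m ! * b ! * q !) (begin
      ((m + b + q) C (m + b)) * ((m + b) C m) * (m ! * b ! * q !)
        ≡⟨ trinomial m b q ⟩
      (m + b + q) !
        ≡⟨ cong _! (ℕ.+-assoc m b q) ⟩
      (m + (b + q)) !
        ≡⟨ [m+n]Cm*m!*n!≡[m+n]! m (b + q) ⟨
      ((m + (b + q)) C m) * (m ! * (b + q) !)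
        ≡⟨ cong (λ x → ((m + (b + q)) C m) * (m ! * x)) ([m+n]Cm*m!*n!≡[m+n]! b q) ⟨
      ((m + (b + q)) C m) * (m ! * (((b + q) C b) * (b ! * q !)))
        ≡⟨ solve 5 (λ X Y M B Q → X :* (M :* (Y :* (B :* Q))) := X :* Y :* (M :* B :* Q)) refl
             ((m + (b + q)) C m) ((b + q) C b) (m !) (b !) (q !) ⟩
      ((m + (b + q)) C m) * ((b + q) C b) * (m ! * b ! * q !)
        ≡⟨ cong (λ x → ((m + (b + q)) C m) * (x C b) * (m ! * b ! * q !)) (ℕ.m+n∸m≡n m (b + q)) ⟨
      ((m + (b + q)) C m) * ((m + (b + q) ∸ m) C b) * (m ! * b ! * q !)
        ≡⟨ cong (λ x → (x C m) * ((x ∸ m) C b) * (m ! * b ! * q !)) (ℕ.+-assoc m b q) ⟨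
      ((m + b + q) C m) * ((m + b + q ∸ m) C b) * (m ! * b ! * q !) ∎)
      where
      open ≡.≡-Reasoning
      instance _ = ℕ.m*n≢0 (m ! * b !) (q !) {{m !* b !≢0}} {{q !≢0}}
  ... | no m+b≰n = trans (cong (_* ((m + b) C m)) (k>n⇒nCk≡0 (ℕ.≰⇒> m+b≰n))) (sym right-vanishes)
    where
    right-vanishes : (n C m) * ((n ∸ m) C b) ≡ 0
    right-vanishes with m ≤? n
    ... | yes m≤n = trans (cong ((n C m) *_) (k>n⇒nCk≡0 n∸m<b)) (ℕ.*-zeroʳ (n C m))
      where
      n∸m<b : n ∸ m < b
      n∸m<b = ≡.subst (n ∸ m <_) (ℕ.m+n∸m≡n m b) (ℕ.∸-monoˡ-< (ℕ.≰⇒> m+b≰n) m≤n)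
    ... | no m≰n  = cong (_* ((n ∸ m) C b)) (k>n⇒nCk≡0 (ℕ.≰⇒> m≰n))

  ≤ᵇ-true : ∀ {m n} → m ≤ n → (m ≤ᵇ n) ≡ true
  ≤ᵇ-true m≤n = Equivalence.to T-≡ (ℕ.≤⇒≤ᵇ m≤n)

  ≤ᵇ-false : ∀ {m n} → n < m → (m ≤ᵇ n) ≡ false
  ≤ᵇ-false {m} {n} n<m with m ≤ᵇ n | ℕ.≤ᵇ-reflects-≤ m n
  ... | true  | ofʸ m≤n = contradiction m≤n (ℕ.<⇒≱ n<m)
  ... | false | _       = refl

  multinom-vanish : ∀ k l k₁ k₂ → k₁ < l ⊎ k₂ < l → multinom k l k₁ k₂ ≡ 0
  multinom-vanish k l k₁ k₂ (inj₁ k₁<l) rewrite ≤ᵇ-false k₁<l = refl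
  multinom-vanish k l k₁ k₂ (inj₂ k₂<l) rewrite ≤ᵇ-false k₂<l | ∧-zeroʳ (l ≤ᵇ k₁) = refl

  multinom-factorials : ∀ k l k₁ k₂ → l ≤ k₁ → l ≤ k₂ →
    multinom k l k₁ k₂
      ≡ (k ! / (l ! * (k₁ ∸ l) ! * (k₂ ∸ l) !)) {{ℕ.m*n≢0 _ _ {{l !* (k₁ ∸ l) !≢0}} {{(k₂ ∸ l) !≢0}}}}
  multinom-factorials k l k₁ k₂ l≤k₁ l≤k₂ rewrite ≤ᵇ-true l≤k₁ | ≤ᵇ-true l≤k₂ = refl

  multinom-eval : ∀ l a b → multinom (l + a + b) l (l + a) (l + b) ≡ ((l + a + b) C (l + a)) * ((l + a) C l)
  multinom-eval l a b = begin
    multinom (l + a + b) l (l + a) (l + b)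
      ≡⟨ multinom-factorials (l + a + b) l (l + a) (l + b) (ℕ.m≤m+n l a) (ℕ.m≤m+n l b) ⟩
    (l + a + b) ! / (l ! * (l + a ∸ l) ! * (l + b ∸ l) !)
      ≡⟨ /-congʳ (cong₂ (λ u v → l ! * u ! * v !) (ℕ.m+n∸m≡n l a) (ℕ.m+n∸m≡n l b)) ⟩
    (l + a + b) ! / (l ! * a ! * b !)
      ≡⟨ /-congˡ (trinomial l a b) ⟨
    ((l + a + b) C (l + a)) * ((l + a) C l) * (l ! * a ! * b !) / (l ! * a ! * b !)
      ≡⟨ m*n/n≡m _ (l ! * a ! * b !) ⟩
    ((l + a + b) C (l + a)) * ((l + a) C l) ∎
    where
    open ≡.≡-Reasoning
    instance
      _ = ℕ.m*n≢0 _ _ {{l !* (l + a ∸ l) !≢0}} {{(l + b ∸ l) !≢0}}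
      _ = ℕ.m*n≢0 _ _ {{l !* a !≢0}} {{b !≢0}}

  eqInd-≡ : ∀ k l k₁ k₂ → k + l ≡ k₁ + k₂ → eqInd k l k₁ k₂ ≡ 1
  eqInd-≡ k l k₁ k₂ eq rewrite Equivalence.to T-≡ (ℕ.≡⇒≡ᵇ (k₁ + k₂) (k + l) (sym eq)) = refl

  eqInd-≢ : ∀ k l k₁ k₂ → k + l ≢ k₁ + k₂ → eqInd k l k₁ k₂ ≡ 0
  eqInd-≢ k l k₁ k₂ neq with (k₁ + k₂) ≡ᵇ (k + l) | ℕ.≡ᵇ⇒≡ (k₁ + k₂) (k + l)
  ... | true  | eq = contradiction (sym (eq _)) neq
  ... | false | _  = refl

  Σ≤-eqInd : ∀ n l k₁ k₂ K (g : ℕ → ℕ) → K + l ≡ k₁ + k₂ →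
    ∑[ k ≤ n ] (n C k) * (eqInd k l k₁ k₂ * g k) ≡ (n C K) * g K
  Σ≤-eqInd n l k₁ k₂ K g K+l≡ = collapse (K ≤? n)
    where
    off : ∀ k → k ≢ K → (n C k) * (eqInd k l k₁ k₂ * g k) ≡ 0
    off k k≢K = trans (cong (λ e → (n C k) * (e * g k)) (eqInd-≢ k l k₁ k₂ (k≢K ∘ cancel)))
                      (ℕ.*-zeroʳ (n C k))
      where
      cancel : k + l ≡ k₁ + k₂ → k ≡ K
      cancel eq = ℕ.+-cancelʳ-≡ l k K (trans eq (sym K+l≡))
    collapse : Dec (K ≤ n) → ∑[ k ≤ n ] (n C k) * (eqInd k l k₁ k₂ * g k) ≡ (n C K) * g K
    collapse (yes K≤n) = trans (Σ≤-point _ K≤n off)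
      (cong ((n C K) *_) (trans (cong (_* g K) (eqInd-≡ K l k₁ k₂ K+l≡)) (ℕ.*-identityˡ (g K))))
    collapse (no  K≰n) = trans (Σ≤-zero n (λ k k≤n → off k (λ k≡K → K≰n (≡.subst (_≤ n) k≡K k≤n))))
                               (sym (cong (_* g K) (k>n⇒nCk≡0 (ℕ.≰⇒> K≰n))))

  pairs-with-intersection-vanish : ∀ n l k₁ k₂ → k₁ < l ⊎ k₂ < l →
    ∑[ k ≤ n ] (n C k) * (eqInd k l k₁ k₂ * multinom k l k₁ k₂) ≡ 0
  pairs-with-intersection-vanish n l k₁ k₂ l-too-big = Σ≤-zero n λ k _ → begin
    (n C k) * (eqInd k l k₁ k₂ * multinom k l k₁ k₂)
      ≡⟨ cong (λ x → (n C k) * (eqInd k l k₁ k₂ * x)) (multinom-vanish k l k₁ k₂ l-too-big) ⟩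
    (n C k) * (eqInd k l k₁ k₂ * 0)
      ≡⟨ cong ((n C k) *_) (ℕ.*-zeroʳ (eqInd k l k₁ k₂)) ⟩
    (n C k) * 0
      ≡⟨ ℕ.*-zeroʳ (n C k) ⟩
    0 ∎
    where open ≡.≡-Reasoning

  pairs-with-intersection : ∀ n l k₁ k₂ → l ≤ k₂ →
    ∑[ k ≤ n ] (n C k) * (eqInd k l k₁ k₂ * multinom k l k₁ k₂) ≡ (n C k₁) * ((k₁ C l) * ((n ∸ k₁) C (k₂ ∸ l)))
  pairs-with-intersection n l k₁ k₂ l≤k₂ with l ≤? k₁
  ... | no l≰k₁ = begin
    ∑[ k ≤ n ] (n C k) * (eqInd k l k₁ k₂ * multinom k l k₁ k₂)
      ≡⟨ pairs-with-intersection-vanish n l k₁ k₂ (inj₁ (ℕ.≰⇒> l≰k₁)) ⟩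
    0
      ≡⟨ ℕ.*-zeroʳ (n C k₁) ⟨
    (n C k₁) * 0
      ≡⟨ cong (λ x → (n C k₁) * (x * ((n ∸ k₁) C (k₂ ∸ l)))) (k>n⇒nCk≡0 (ℕ.≰⇒> l≰k₁)) ⟨
    (n C k₁) * ((k₁ C l) * ((n ∸ k₁) C (k₂ ∸ l))) ∎
    where open ≡.≡-Reasoning
  ... | yes l≤k₁ = decompose (k₁ ∸ l) (k₂ ∸ l) (ℕ.m+[n∸m]≡n l≤k₁) (ℕ.m+[n∸m]≡n l≤k₂)
    where
    open ≡.≡-Reasoning
    decompose : ∀ a b → l + a ≡ k₁ → l + b ≡ k₂ →
      ∑[ k ≤ n ] (n C k) * (eqInd k l k₁ k₂ * multinom k l k₁ k₂) ≡ (n C k₁) * ((k₁ C l) * ((n ∸ k₁) C (k₂ ∸ l)))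
    decompose a b refl refl = begin
      ∑[ k ≤ n ] (n C k) * (eqInd k l (l + a) (l + b) * multinom k l (l + a) (l + b))
        ≡⟨ Σ≤-eqInd n l (l + a) (l + b) (l + a + b) (λ k → multinom k l (l + a) (l + b))
             (solve 3 (λ l a b → l :+ a :+ b :+ l := l :+ a :+ (l :+ b)) refl l a b) ⟩
      (n C (l + a + b)) * multinom (l + a + b) l (l + a) (l + b)
        ≡⟨ cong ((n C (l + a + b)) *_) (multinom-eval l a b) ⟩
      (n C (l + a + b)) * (((l + a + b) C (l + a)) * ((l + a) C l))
        ≡⟨ ℕ.*-assoc (n C (l + a + b)) _ _ ⟨
      (n C (l + a + b)) * ((l + a + b) C (l + a)) * ((l + a) C l)
        ≡⟨ cong (_* ((l + a) C l)) (subset-of-subset n (l + a) b) ⟩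
      (n C (l + a)) * ((n ∸ (l + a)) C b) * ((l + a) C l)
        ≡⟨ solve 3 (λ x y z → x :* y :* z := x :* (z :* y)) refl (n C (l + a)) ((n ∸ (l + a)) C b) ((l + a) C l) ⟩
      (n C (l + a)) * (((l + a) C l) * ((n ∸ (l + a)) C b))
        ≡⟨ cong (λ x → (n C (l + a)) * (((l + a) C l) * ((n ∸ (l + a)) C x))) (ℕ.m+n∸m≡n l b) ⟨
      (n C (l + a)) * (((l + a) C l) * ((n ∸ (l + a)) C (l + b ∸ l))) ∎

  -- Pairs (A, B) of subsets of [n] with |A| = k₁, |B| = k₂, sorted by k = |A ∪ B| and l = |A ∩ B|.
  binomial-product : ∀ n k₁ k₂ R → k₁ ≤ R →
    ∑[ k ≤ n ] (n C k) * (∑[ l ≤ R ] eqInd k l k₁ k₂ * multinom k l k₁ k₂) ≡ (n C k₁) * (n C k₂)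
  binomial-product n k₁ k₂ R k₁≤R = begin
    ∑[ k ≤ n ] (n C k) * (∑[ l ≤ R ] eqInd k l k₁ k₂ * multinom k l k₁ k₂)
      ≡⟨ Σ≤-cong n (λ k _ → *-distribˡ-Σ≤ R (n C k) _) ⟩
    ∑[ k ≤ n ] ∑[ l ≤ R ] (n C k) * (eqInd k l k₁ k₂ * multinom k l k₁ k₂)
      ≡⟨ Σ≤-comm n R _ ⟩
    ∑[ l ≤ R ] pairs l
      ≡⟨ Σ≤-extend pairs (ℕ.m≤m+n R k₂)
           (λ l R<l → pairs-with-intersection-vanish n l k₁ k₂ (inj₁ (ℕ.≤-<-trans k₁≤R R<l))) ⟨
    ∑[ l ≤ R + k₂ ] pairs l
      ≡⟨ Σ≤-extend pairs (ℕ.m≤n+m k₂ R) (λ l k₂<l → pairs-with-intersection-vanish n l k₁ k₂ (inj₂ k₂<l)) ⟩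
    ∑[ l ≤ k₂ ] pairs l
      ≡⟨ Σ≤-cong k₂ (λ l l≤k₂ → pairs-with-intersection n l k₁ k₂ l≤k₂) ⟩
    ∑[ l ≤ k₂ ] (n C k₁) * ((k₁ C l) * ((n ∸ k₁) C (k₂ ∸ l)))
      ≡⟨ *-distribˡ-Σ≤ k₂ (n C k₁) _ ⟨
    (n C k₁) * (∑[ l ≤ k₂ ] (k₁ C l) * ((n ∸ k₁) C (k₂ ∸ l)))
      ≡⟨ cong ((n C k₁) *_) (vandermonde k₁ (n ∸ k₁) k₂) ⟩
    (n C k₁) * ((k₁ + (n ∸ k₁)) C k₂)
      ≡⟨ complement (k₁ ≤? n) ⟩
    (n C k₁) * (n C k₂) ∎
    where
    open ≡.≡-Reasoning
    pairs : ℕ → ℕ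
    pairs l = ∑[ k ≤ n ] (n C k) * (eqInd k l k₁ k₂ * multinom k l k₁ k₂)
    complement : Dec (k₁ ≤ n) → (n C k₁) * ((k₁ + (n ∸ k₁)) C k₂) ≡ (n C k₁) * (n C k₂)
    complement (yes k₁≤n) = cong (λ m → (n C k₁) * (m C k₂)) (ℕ.m+[n∸m]≡n k₁≤n)
    complement (no k₁≰n)  = trans (cong (_* ((k₁ + (n ∸ k₁)) C k₂)) n<k₁) (sym (cong (_* (n C k₂)) n<k₁))
      where n<k₁ = k>n⇒nCk≡0 (ℕ.≰⇒> k₁≰n)

  -- The case of two multisets

  B-vanish : ∀ {r k} → r < k → B r k ≡ 0
  B-vanish {zero}  {suc k} _         = refl
  B-vanish {suc r} {suc k} (s≤s r<k) = k>n⇒nCk≡0 r<k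

  ctilde-singleton : ∀ r k → ctilde (r ∷ []) k ≡ B r k
  ctilde-singleton zero    zero    = refl
  ctilde-singleton (suc r) zero    = refl
  ctilde-singleton r       (suc k) = begin
    ctilde (r ∷ []) (suc k)
      ≡⟨ ctilde-suc (r ∷ []) k ⟩
    ∑ₗ[ a ∈ columns (r ∷ []) ] (if anyV isPos a then ctilde ((r ∷ []) ∸ᵛ a) k else 0)
      ≡⟨ ∑ₗ-concatMap-map (λ a → if anyV isPos a then ctilde ((r ∷ []) ∸ᵛ a) k else 0)
           _∷_ (λ _ → columns []) (upTo (suc r)) ⟩
    ∑ₗ[ a ∈ upTo (suc r) ] ((if isPos a ∨ false then ctilde ((r ∸ a) ∷ []) k else 0) + 0)
      ≡⟨ ∑ₗ-upTo (λ a → (if isPos a ∨ false then ctilde ((r ∸ a) ∷ []) k else 0) + 0) r ⟩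
    ∑[ a ≤ r ] ((if isPos a ∨ false then ctilde ((r ∸ a) ∷ []) k else 0) + 0)
      ≡⟨ nonzero-columns r ⟩
    B r (suc k) ∎
    where
    open ≡.≡-Reasoning
    nonzero-columns : ∀ r → ∑[ a ≤ r ] ((if isPos a ∨ false then ctilde ((r ∸ a) ∷ []) k else 0) + 0) ≡ B r (suc k)
    nonzero-columns zero    = refl
    nonzero-columns (suc r) =
      trans (Σ≤-cong r (λ a _ → trans (ℕ.+-identityʳ _) (ctilde-singleton (r ∸ a) k))) (hockey-stick r k)

  #multisets-binomial : ∀ n r → #multisets n r ≡ ∑[ k ≤ r ] (n C k) * B r k
  #multisets-binomial n r = begin
    #multisets n r
      ≡⟨ ℕ.*-identityʳ (#multisets n r) ⟨
    #multisets n r * #tuples [] n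
      ≡⟨ #tuples-∷ r [] n ⟨
    #tuples (r ∷ []) n
      ≡⟨ #tuples-binomial (r ∷ []) n ⟩
    ∑[ k ≤ n ] (n C k) * ctilde (r ∷ []) k
      ≡⟨ Σ≤-cong n (λ k _ → cong ((n C k) *_) (ctilde-singleton r k)) ⟩
    ∑[ k ≤ n ] (n C k) * B r k
      ≡⟨ Σ≤-extend term (ℕ.m≤m+n n r) (λ k n<k → cong (_* B r k) (k>n⇒nCk≡0 n<k)) ⟨
    ∑[ k ≤ n + r ] (n C k) * B r k
      ≡⟨ Σ≤-extend term (ℕ.m≤n+m r n) (λ k r<k → trans (cong ((n C k) *_) (B-vanish r<k)) (ℕ.*-zeroʳ (n C k))) ⟩
    ∑[ k ≤ r ] (n C k) * B r k ∎
    where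
    open ≡.≡-Reasoning
    term : ℕ → ℕ
    term k = (n C k) * B r k

  formula2-regrouped : ∀ r₁ r₂ k → formula2 r₁ r₂ k ≡
    ∑[ k₁ ≤ r₁ ] ∑[ k₂ ≤ r₂ ] (B r₁ k₁ * B r₂ k₂) * (∑[ l ≤ r₁ ] eqInd k l k₁ k₂ * multinom k l k₁ k₂)
  formula2-regrouped r₁ r₂ k = begin
    formula2 r₁ r₂ k
      ≡⟨ trans (∑ₗ-upTo _ r₁) (Σ≤-cong r₁ (λ l _ → trans (∑ₗ-upTo _ r₁) (Σ≤-cong r₁ (λ k₁ _ → ∑ₗ-upTo _ r₂)))) ⟩
    ∑[ l ≤ r₁ ] ∑[ k₁ ≤ r₁ ] ∑[ k₂ ≤ r₂ ] eqInd k l k₁ k₂ * (multinom k l k₁ k₂ * (B r₁ k₁ * B r₂ k₂))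
      ≡⟨ Σ≤-sink r₁ r₁ r₂ _ ⟩
    ∑[ k₁ ≤ r₁ ] ∑[ k₂ ≤ r₂ ] ∑[ l ≤ r₁ ] eqInd k l k₁ k₂ * (multinom k l k₁ k₂ * (B r₁ k₁ * B r₂ k₂))
      ≡⟨ Σ≤-cong r₁ (λ k₁ _ → Σ≤-cong r₂ (λ k₂ _ → factor k₁ k₂)) ⟩
    ∑[ k₁ ≤ r₁ ] ∑[ k₂ ≤ r₂ ] (B r₁ k₁ * B r₂ k₂) * (∑[ l ≤ r₁ ] eqInd k l k₁ k₂ * multinom k l k₁ k₂) ∎
    where
    open ≡.≡-Reasoning
    reorder : ∀ l k₁ k₂ → eqInd k l k₁ k₂ * (multinom k l k₁ k₂ * (B r₁ k₁ * B r₂ k₂))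
                        ≡ (B r₁ k₁ * B r₂ k₂) * (eqInd k l k₁ k₂ * multinom k l k₁ k₂)
    reorder l k₁ k₂ = trans (sym (ℕ.*-assoc (eqInd k l k₁ k₂) _ _)) (ℕ.*-comm _ (B r₁ k₁ * B r₂ k₂))
    factor : ∀ k₁ k₂ → ∑[ l ≤ r₁ ] eqInd k l k₁ k₂ * (multinom k l k₁ k₂ * (B r₁ k₁ * B r₂ k₂))
                     ≡ (B r₁ k₁ * B r₂ k₂) * (∑[ l ≤ r₁ ] eqInd k l k₁ k₂ * multinom k l k₁ k₂)
    factor k₁ k₂ = trans (Σ≤-cong r₁ (λ l _ → reorder l k₁ k₂))
      (sym (*-distribˡ-Σ≤ r₁ (B r₁ k₁ * B r₂ k₂) (λ l → eqInd k l k₁ k₂ * multinom k l k₁ k₂)))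

  formula2-binomial : ∀ r₁ r₂ n → ∑[ k ≤ n ] (n C k) * formula2 r₁ r₂ k ≡ #multisets n r₁ * #multisets n r₂
  formula2-binomial r₁ r₂ n = begin
    ∑[ k ≤ n ] (n C k) * formula2 r₁ r₂ k
      ≡⟨ Σ≤-cong n (λ k _ → cong ((n C k) *_) (formula2-regrouped r₁ r₂ k)) ⟩
    ∑[ k ≤ n ] (n C k) * (∑[ k₁ ≤ r₁ ] ∑[ k₂ ≤ r₂ ] B₁₂ k₁ k₂ * overlaps k k₁ k₂)
      ≡⟨ Σ≤-cong n (λ k _ → distribute k) ⟩
    ∑[ k ≤ n ] ∑[ k₁ ≤ r₁ ] ∑[ k₂ ≤ r₂ ] B₁₂ k₁ k₂ * ((n C k) * overlaps k k₁ k₂)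
      ≡⟨ Σ≤-sink n r₁ r₂ _ ⟩
    ∑[ k₁ ≤ r₁ ] ∑[ k₂ ≤ r₂ ] ∑[ k ≤ n ] B₁₂ k₁ k₂ * ((n C k) * overlaps k k₁ k₂)
      ≡⟨ Σ≤-cong r₁ (λ k₁ k₁≤r₁ → Σ≤-cong r₂ (λ k₂ _ → trans (sym (*-distribˡ-Σ≤ n (B₁₂ k₁ k₂) _))
           (cong (B₁₂ k₁ k₂ *_) (binomial-product n k₁ k₂ r₁ k₁≤r₁)))) ⟩
    ∑[ k₁ ≤ r₁ ] ∑[ k₂ ≤ r₂ ] B₁₂ k₁ k₂ * ((n C k₁) * (n C k₂))
      ≡⟨ Σ≤-cong r₁ (λ k₁ _ → Σ≤-cong r₂ (λ k₂ _ →
           solve 4 (λ x y u v → (x :* y) :* (u :* v) := (u :* x) :* (v :* y)) refl (B r₁ k₁) (B r₂ k₂) (n C k₁) (n C k₂))) ⟩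
    ∑[ k₁ ≤ r₁ ] ∑[ k₂ ≤ r₂ ] ((n C k₁) * B r₁ k₁) * ((n C k₂) * B r₂ k₂)
      ≡⟨ Σ≤-*-Σ≤ r₁ r₂ _ _ ⟨
    (∑[ k₁ ≤ r₁ ] (n C k₁) * B r₁ k₁) * (∑[ k₂ ≤ r₂ ] (n C k₂) * B r₂ k₂)
      ≡⟨ cong₂ _*_ (#multisets-binomial n r₁) (#multisets-binomial n r₂) ⟨
    #multisets n r₁ * #multisets n r₂ ∎
    where
    open ≡.≡-Reasoning
    B₁₂ : ℕ → ℕ → ℕ
    B₁₂ k₁ k₂ = B r₁ k₁ * B r₂ k₂
    overlaps : ℕ → ℕ → ℕ → ℕ
    overlaps k k₁ k₂ = ∑[ l ≤ r₁ ] eqInd k l k₁ k₂ * multinom k l k₁ k₂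
    distribute : ∀ k → (n C k) * (∑[ k₁ ≤ r₁ ] ∑[ k₂ ≤ r₂ ] B₁₂ k₁ k₂ * overlaps k k₁ k₂)
                     ≡ ∑[ k₁ ≤ r₁ ] ∑[ k₂ ≤ r₂ ] B₁₂ k₁ k₂ * ((n C k) * overlaps k k₁ k₂)
    distribute k = trans (*-distribˡ-Σ≤ r₁ (n C k) (λ k₁ → ∑[ k₂ ≤ r₂ ] B₁₂ k₁ k₂ * overlaps k k₁ k₂)) (Σ≤-cong r₁ (λ k₁ _ →
      trans (*-distribˡ-Σ≤ r₂ (n C k) (λ k₂ → B₁₂ k₁ k₂ * overlaps k k₁ k₂)) (Σ≤-cong r₂ (λ k₂ _ →
        solve 3 (λ x y z → x :* (y :* z) := y :* (x :* z)) refl (n C k) (B₁₂ k₁ k₂) (overlaps k k₁ k₂)))))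

  ctilde-pair≡formula2 : ∀ r₁ r₂ k → ctilde (r₁ ∷ r₂ ∷ []) k ≡ formula2 r₁ r₂ k
  ctilde-pair≡formula2 r₁ r₂ k = unitriangular-injective ℕ.+-cancelˡ-≡ _C_ nCn≡1 k transforms-agree k ℕ.≤-refl
    where
    transforms-agree : ∀ n → n ≤ k →
      ∑[ j ≤ n ] (n C j) * ctilde (r₁ ∷ r₂ ∷ []) j ≡ ∑[ j ≤ n ] (n C j) * formula2 r₁ r₂ j
    transforms-agree n _ = begin
      ∑[ j ≤ n ] (n C j) * ctilde (r₁ ∷ r₂ ∷ []) j  ≡⟨ #tuples-binomial (r₁ ∷ r₂ ∷ []) n ⟨
      #tuples (r₁ ∷ r₂ ∷ []) n                      ≡⟨ #tuples-∷ r₁ (r₂ ∷ []) n ⟩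
      #multisets n r₁ * #tuples (r₂ ∷ []) n         ≡⟨ cong (#multisets n r₁ *_) (trans (#tuples-∷ r₂ [] n) (ℕ.*-identityʳ _)) ⟩
      #multisets n r₁ * #multisets n r₂             ≡⟨ formula2-binomial r₁ r₂ n ⟨
      ∑[ j ≤ n ] (n C j) * formula2 r₁ r₂ j         ∎
      where open ≡.≡-Reasoning

-- Polynomials in the binomial basis

module _ where
  open ℚΣ
  open import Data.Rational.Base using (ℚ; 0ℚ; 1ℚ; mkℚ; _+_; _*_; _-_; _/_)
  open import Data.Nat.Base using (_!)
  open import Data.Rational.Solver using (module +-*-Solver)
  open import Algebra.Properties.Semiring.Mult (CommutativeRing.semiring ℚ.+-*-commutativeRing) using (_×_; ×-homo-+; ×1-homo-*)
  open import Algebra.Properties.Group (CommutativeRing.+-group ℚ.+-*-commutativeRing) using (∙-cancelˡ)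
  open +-*-Solver
  open ≡.≡-Reasoning

  ℕtoℚ≡mkℚ : ∀ n → ℕtoℚ n ≡ mkℚ (ℤ.+ n) 0 (Coprime.sym (1-coprimeTo n))
  ℕtoℚ≡mkℚ n = ℚ.normalize-coprime (Coprime.sym (1-coprimeTo n))

  ℕtoℚ-suc : ∀ n → ℕtoℚ (suc n) ≡ 1ℚ + ℕtoℚ n
  ℕtoℚ-suc n rewrite ℕtoℚ≡mkℚ n = cong (λ z → (ℤ.+ 1 ℤ.+ z) / 1) (sym (ℤ.*-identityʳ (ℤ.+ n)))

  ℕtoℚ-suc′ : ∀ n → ℕtoℚ (suc n) ≡ ℕtoℚ n + 1ℚ
  ℕtoℚ-suc′ n = trans (ℕtoℚ-suc n) (ℚ.+-comm 1ℚ (ℕtoℚ n))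

  ℕtoℚ≡×1 : ∀ n → ℕtoℚ n ≡ n × 1ℚ
  ℕtoℚ≡×1 zero    = refl
  ℕtoℚ≡×1 (suc n) = trans (ℕtoℚ-suc n) (cong (1ℚ +_) (ℕtoℚ≡×1 n))

  ℕtoℚ-+ : ∀ m n → ℕtoℚ (m ℕ.+ n) ≡ ℕtoℚ m + ℕtoℚ n
  ℕtoℚ-+ m n = trans (ℕtoℚ≡×1 (m ℕ.+ n)) (trans (×-homo-+ 1ℚ m n) (sym (cong₂ _+_ (ℕtoℚ≡×1 m) (ℕtoℚ≡×1 n))))

  ℕtoℚ-* : ∀ m n → ℕtoℚ (m ℕ.* n) ≡ ℕtoℚ m * ℕtoℚ n
  ℕtoℚ-* m n = trans (ℕtoℚ≡×1 (m ℕ.* n)) (trans (×1-homo-* m n) (sym (cong₂ _*_ (ℕtoℚ≡×1 m) (ℕtoℚ≡×1 n))))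

  ℕtoℚ-Σ≤ : ∀ n (f : ℕ → ℕ) → ℕtoℚ (ℕΣ.Σ≤ n f) ≡ ∑[ k ≤ n ] ℕtoℚ (f k)
  ℕtoℚ-Σ≤ zero    f = refl
  ℕtoℚ-Σ≤ (suc n) f = trans (ℕtoℚ-+ (f 0) _) (cong (ℕtoℚ (f 0) +_) (ℕtoℚ-Σ≤ n (f ∘ suc)))

  ℕtoℚ[n]*[1/n]≡1 : ∀ d .{{_ : ℕ.NonZero d}} → ℕtoℚ d * (ℤ.+ 1 / d) ≡ 1ℚ
  ℕtoℚ[n]*[1/n]≡1 (suc d) = trans (cong₂ _*_ (ℕtoℚ≡mkℚ (suc d)) (ℚ.normalize-coprime (1-coprimeTo (suc d))))
    (ℚ.*-inverseʳ (mkℚ (ℤ.+ suc d) 0 (Coprime.sym (1-coprimeTo (suc d)))))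

  ℕtoℚ[n!]*inv!≡1 : ∀ n → ℕtoℚ (n !) * inv! n ≡ 1ℚ
  ℕtoℚ[n!]*inv!≡1 n = ℕtoℚ[n]*[1/n]≡1 (n !) {{n !≢0}}

  inv!-suc : ∀ k → inv! (suc k) * ℕtoℚ (suc k) ≡ inv! k
  inv!-suc k = begin
    inv! (suc k) * ℕtoℚ (suc k)
      ≡⟨ ℚ.*-identityʳ _ ⟨
    inv! (suc k) * ℕtoℚ (suc k) * 1ℚ
      ≡⟨ cong (inv! (suc k) * ℕtoℚ (suc k) *_) (ℕtoℚ[n!]*inv!≡1 k) ⟨
    inv! (suc k) * ℕtoℚ (suc k) * (ℕtoℚ (k !) * inv! k)
      ≡⟨ solve 4 (λ i s f j → i :* s :* (f :* j) := s :* f :* i :* j) refl (inv! (suc k)) (ℕtoℚ (suc k)) (ℕtoℚ (k !)) (inv! k) ⟩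
    ℕtoℚ (suc k) * ℕtoℚ (k !) * inv! (suc k) * inv! k
      ≡⟨ cong (λ z → z * inv! (suc k) * inv! k) (ℕtoℚ-* (suc k) (k !)) ⟨
    ℕtoℚ (suc k !) * inv! (suc k) * inv! k
      ≡⟨ cong (_* inv! k) (ℕtoℚ[n!]*inv!≡1 (suc k)) ⟩
    1ℚ * inv! k
      ≡⟨ ℚ.*-identityˡ (inv! k) ⟩
    inv! k ∎

  rising-suc : ∀ x n → rising x (suc n) ≡ x * rising (x + 1ℚ) n
  rising-suc x zero    = solve 1 (λ x → con 1ℚ :* (x :+ con 0ℚ) := x :* con 1ℚ) refl x
  rising-suc x (suc n) = begin
    rising x (suc n) * (x + ℕtoℚ (suc n))
      ≡⟨ cong₂ (λ r m → r * (x + m)) (rising-suc x n) (ℕtoℚ-suc n) ⟩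
    x * rising (x + 1ℚ) n * (x + (1ℚ + ℕtoℚ n))
      ≡⟨ solve 3 (λ x r m → x :* r :* (x :+ (con 1ℚ :+ m)) := x :* (r :* ((x :+ con 1ℚ) :+ m))) refl x (rising (x + 1ℚ) n) (ℕtoℚ n) ⟩
    x * rising (x + 1ℚ) (suc n) ∎

  falling-suc : ∀ x n → falling x (suc n) ≡ x * falling (x - 1ℚ) n
  falling-suc x zero    = solve 1 (λ x → con 1ℚ :* (x :- con 0ℚ) := x :* con 1ℚ) refl x
  falling-suc x (suc n) = begin
    falling x (suc n) * (x - ℕtoℚ (suc n))
      ≡⟨ cong₂ (λ f m → f * (x - m)) (falling-suc x n) (ℕtoℚ-suc n) ⟩
    x * falling (x - 1ℚ) n * (x - (1ℚ + ℕtoℚ n))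
      ≡⟨ solve 3 (λ x f m → x :* f :* (x :- (con 1ℚ :+ m)) := x :* (f :* ((x :- con 1ℚ) :- m))) refl x (falling (x - 1ℚ) n) (ℕtoℚ n) ⟩
    x * falling (x - 1ℚ) (suc n) ∎

  mset-pascal : ∀ x r → mset (x + 1ℚ) (suc r) ≡ mset (x + 1ℚ) r + mset x (suc r)
  mset-pascal x r = begin
    rising (x + 1ℚ) r * (x + 1ℚ + ℕtoℚ r) * inv! (suc r)
      ≡⟨ solve 4 (λ x p m i → p :* (x :+ con 1ℚ :+ m) :* i := p :* (i :* (con 1ℚ :+ m)) :+ x :* p :* i) refl
           x (rising (x + 1ℚ) r) (ℕtoℚ r) (inv! (suc r)) ⟩
    rising (x + 1ℚ) r * (inv! (suc r) * (1ℚ + ℕtoℚ r)) + x * rising (x + 1ℚ) r * inv! (suc r)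
      ≡⟨ cong₂ (λ m p → rising (x + 1ℚ) r * (inv! (suc r) * m) + p * inv! (suc r)) (ℕtoℚ-suc r) (rising-suc x r) ⟨
    rising (x + 1ℚ) r * (inv! (suc r) * ℕtoℚ (suc r)) + rising x (suc r) * inv! (suc r)
      ≡⟨ cong (λ i → rising (x + 1ℚ) r * i + mset x (suc r)) (inv!-suc r) ⟩
    mset (x + 1ℚ) r + mset x (suc r) ∎

  binomℚ-pascal : ∀ x k → binomℚ (x + 1ℚ) (suc k) ≡ binomℚ x k + binomℚ x (suc k)
  binomℚ-pascal x k = begin
    falling (x + 1ℚ) (suc k) * inv! (suc k)
      ≡⟨ cong (_* inv! (suc k)) (falling-suc (x + 1ℚ) k) ⟩
    (x + 1ℚ) * falling (x + 1ℚ - 1ℚ) k * inv! (suc k)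
      ≡⟨ cong (λ y → (x + 1ℚ) * falling y k * inv! (suc k)) (solve 1 (λ x → x :+ con 1ℚ :- con 1ℚ := x) refl x) ⟩
    (x + 1ℚ) * falling x k * inv! (suc k)
      ≡⟨ solve 4 (λ x f m i → (x :+ con 1ℚ) :* f :* i := f :* (i :* (con 1ℚ :+ m)) :+ f :* (x :- m) :* i) refl
           x (falling x k) (ℕtoℚ k) (inv! (suc k)) ⟩
    falling x k * (inv! (suc k) * (1ℚ + ℕtoℚ k)) + falling x (suc k) * inv! (suc k)
      ≡⟨ cong (λ m → falling x k * (inv! (suc k) * m) + binomℚ x (suc k)) (ℕtoℚ-suc k) ⟨
    falling x k * (inv! (suc k) * ℕtoℚ (suc k)) + binomℚ x (suc k)
      ≡⟨ cong (λ i → falling x k * i + binomℚ x (suc k)) (inv!-suc k) ⟩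
    binomℚ x k + binomℚ x (suc k) ∎

  binomℚ-absorb : ∀ x k → binomℚ x (suc k) * ℕtoℚ (suc k) ≡ binomℚ x k * (x - ℕtoℚ k)
  binomℚ-absorb x k = begin
    falling x k * (x - ℕtoℚ k) * inv! (suc k) * ℕtoℚ (suc k)
      ≡⟨ solve 4 (λ f y i s → f :* y :* i :* s := f :* (i :* s) :* y) refl (falling x k) (x - ℕtoℚ k) (inv! (suc k)) (ℕtoℚ (suc k)) ⟩
    falling x k * (inv! (suc k) * ℕtoℚ (suc k)) * (x - ℕtoℚ k)
      ≡⟨ cong (λ i → falling x k * i * (x - ℕtoℚ k)) (inv!-suc k) ⟩
    binomℚ x k * (x - ℕtoℚ k) ∎

  binomℚ-*-linear : ∀ x a k →
    (x + ℕtoℚ a) * binomℚ x k ≡ (ℕtoℚ k + ℕtoℚ a) * binomℚ x k + ℕtoℚ (suc k) * binomℚ x (suc k)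
  binomℚ-*-linear x a k = begin
    (x + ℕtoℚ a) * binomℚ x k
      ≡⟨ solve 4 (λ x A K b → (x :+ A) :* b := (K :+ A) :* b :+ b :* (x :- K)) refl x (ℕtoℚ a) (ℕtoℚ k) (binomℚ x k) ⟩
    (ℕtoℚ k + ℕtoℚ a) * binomℚ x k + binomℚ x k * (x - ℕtoℚ k)
      ≡⟨ cong ((ℕtoℚ k + ℕtoℚ a) * binomℚ x k +_) (trans (ℚ.*-comm (ℕtoℚ (suc k)) _) (binomℚ-absorb x k)) ⟨
    (ℕtoℚ k + ℕtoℚ a) * binomℚ x k + ℕtoℚ (suc k) * binomℚ x (suc k) ∎

  mset-ℕ : ∀ j r → mset (ℕtoℚ j) r ≡ ℕtoℚ (#multisets j r)
  mset-ℕ j       zero    = cong ℕtoℚ (sym (#multisets-zero j))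
  mset-ℕ zero    (suc r) =
    trans (cong (_* inv! (suc r)) (trans (rising-suc 0ℚ r) (ℚ.*-zeroˡ (rising 1ℚ r)))) (ℚ.*-zeroˡ (inv! (suc r)))
  mset-ℕ (suc j) (suc r) = begin
    mset (ℕtoℚ (suc j)) (suc r)                              ≡⟨ cong (λ y → mset y (suc r)) (ℕtoℚ-suc′ j) ⟩
    mset (ℕtoℚ j + 1ℚ) (suc r)                               ≡⟨ mset-pascal (ℕtoℚ j) r ⟩
    mset (ℕtoℚ j + 1ℚ) r + mset (ℕtoℚ j) (suc r)             ≡⟨ cong (λ y → mset y r + mset (ℕtoℚ j) (suc r)) (ℕtoℚ-suc′ j) ⟨
    mset (ℕtoℚ (suc j)) r + mset (ℕtoℚ j) (suc r)            ≡⟨ cong₂ _+_ (mset-ℕ (suc j) r) (mset-ℕ j (suc r)) ⟩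
    ℕtoℚ (#multisets (suc j) r) + ℕtoℚ (#multisets j (suc r)) ≡⟨ ℕtoℚ-+ (#multisets (suc j) r) _ ⟨
    ℕtoℚ (#multisets (suc j) r ℕ.+ #multisets j (suc r))      ≡⟨ cong ℕtoℚ (#multisets-pascal j r) ⟨
    ℕtoℚ (#multisets (suc j) (suc r))                        ∎

  binomℚ-ℕ : ∀ j k → binomℚ (ℕtoℚ j) k ≡ ℕtoℚ (j C k)
  binomℚ-ℕ j       zero    = refl
  binomℚ-ℕ zero    (suc k) =
    trans (cong (_* inv! (suc k)) (trans (falling-suc 0ℚ k) (ℚ.*-zeroˡ (falling (0ℚ - 1ℚ) k)))) (ℚ.*-zeroˡ (inv! (suc k)))
  binomℚ-ℕ (suc j) (suc k) = begin
    binomℚ (ℕtoℚ (suc j)) (suc k)                ≡⟨ cong (λ y → binomℚ y (suc k)) (ℕtoℚ-suc′ j) ⟩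
    binomℚ (ℕtoℚ j + 1ℚ) (suc k)                 ≡⟨ binomℚ-pascal (ℕtoℚ j) k ⟩
    binomℚ (ℕtoℚ j) k + binomℚ (ℕtoℚ j) (suc k)  ≡⟨ cong₂ _+_ (binomℚ-ℕ j k) (binomℚ-ℕ j (suc k)) ⟩
    ℕtoℚ (j C k) + ℕtoℚ (j C suc k)              ≡⟨ ℕtoℚ-+ (j C k) _ ⟨
    ℕtoℚ (j C k ℕ.+ j C suc k)                   ≡⟨ cong ℕtoℚ (nCk+nC[k+1]≡[n+1]C[k+1] j k) ⟩
    ℕtoℚ (suc j C suc k)                         ∎

  prodℚ-mset-ℕ : ∀ {m} j (rs : Vec ℕ m) → prodℚ (Vec.map (mset (ℕtoℚ j)) rs) ≡ ℕtoℚ (#tuples rs j)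
  prodℚ-mset-ℕ j []       = refl
  prodℚ-mset-ℕ j (r ∷ rs) = begin
    mset (ℕtoℚ j) r * prodℚ (Vec.map (mset (ℕtoℚ j)) rs)  ≡⟨ cong₂ _*_ (mset-ℕ j r) (prodℚ-mset-ℕ j rs) ⟩
    ℕtoℚ (#multisets j r) * ℕtoℚ (#tuples rs j)           ≡⟨ ℕtoℚ-* (#multisets j r) _ ⟨
    ℕtoℚ (#multisets j r ℕ.* #tuples rs j)                ≡⟨ cong ℕtoℚ (#tuples-∷ r rs j) ⟨
    ℕtoℚ (#tuples (r ∷ rs) j)                             ∎

  record BinomialExpansion (d : ℕ) (F : ℚ → ℚ) : Set where
    field
      coeff  : ℕ → ℚ
      vanish : ∀ k → d < k → coeff k ≡ 0ℚ
      expand : ∀ x → F x ≡ ∑[ k ≤ d ] coeff k * binomℚ x k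

  open BinomialExpansion

  expansion-one : BinomialExpansion 0 (λ _ → 1ℚ)
  expansion-one = record { coeff = δ₀ ; vanish = λ { (suc k) _ → refl } ; expand = λ _ → refl }
    where
    δ₀ : ℕ → ℚ
    δ₀ zero    = 1ℚ
    δ₀ (suc _) = 0ℚ

  expansion-cong : ∀ {d F G} → (∀ x → F x ≡ G x) → BinomialExpansion d F → BinomialExpansion d G
  expansion-cong F≗G E = record { coeff = coeff E ; vanish = vanish E ; expand = λ x → trans (sym (F≗G x)) (expand E x) }

  expansion-raise : ∀ {d d′ F} → d ≤ d′ → BinomialExpansion d F → BinomialExpansion d′ F
  expansion-raise {d} {d′} d≤d′ E = record
    { coeff  = coeff E
    ; vanish = λ k d′<k → vanish E k (ℕ.≤-<-trans d≤d′ d′<k)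
    ; expand = λ x → trans (expand E x)
        (sym (Σ≤-extend _ d≤d′ (λ k d<k → trans (cong (_* binomℚ x k) (vanish E k d<k)) (ℚ.*-zeroˡ (binomℚ x k)))))
    }

  expansion-scale : ∀ {d F} q → BinomialExpansion d F → BinomialExpansion d (λ x → q * F x)
  expansion-scale {d} q E = record
    { coeff  = λ k → q * coeff E k
    ; vanish = λ k d<k → trans (cong (q *_) (vanish E k d<k)) (ℚ.*-zeroʳ q)
    ; expand = λ x → trans (cong (q *_) (expand E x))
        (trans (*-distribˡ-Σ≤ d q _) (Σ≤-cong d (λ k _ → sym (ℚ.*-assoc q (coeff E k) (binomℚ x k)))))
    }

  expansion-*-linear : ∀ {d F} a → BinomialExpansion d F → BinomialExpansion (suc d) (λ x → (x + ℕtoℚ a) * F x)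
  expansion-*-linear {d} {F} a E = record { coeff = coeff′ ; vanish = vanish′ ; expand = expand′ }
    where
    c = coeff E
    from-below : ℕ → ℚ
    from-below zero    = 0ℚ
    from-below (suc k) = ℕtoℚ (suc k) * c k
    coeff′ : ℕ → ℚ
    coeff′ k = (ℕtoℚ k + ℕtoℚ a) * c k + from-below k
    vanish′ : ∀ k → suc d < k → coeff′ k ≡ 0ℚ
    vanish′ (suc k) (s≤s d<k) = begin
      (ℕtoℚ (suc k) + ℕtoℚ a) * c (suc k) + ℕtoℚ (suc k) * c k
        ≡⟨ cong₂ (λ u v → (ℕtoℚ (suc k) + ℕtoℚ a) * u + ℕtoℚ (suc k) * v) (vanish E (suc k) (ℕ.m<n⇒m<1+n d<k)) (vanish E k d<k) ⟩
      (ℕtoℚ (suc k) + ℕtoℚ a) * 0ℚ + ℕtoℚ (suc k) * 0ℚ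
        ≡⟨ solve 2 (λ u v → u :* con 0ℚ :+ v :* con 0ℚ := con 0ℚ) refl (ℕtoℚ (suc k) + ℕtoℚ a) (ℕtoℚ (suc k)) ⟩
      0ℚ ∎
    expand′ : ∀ x → (x + ℕtoℚ a) * F x ≡ ∑[ k ≤ suc d ] coeff′ k * binomℚ x k
    expand′ x = begin
      (x + ℕtoℚ a) * F x
        ≡⟨ cong ((x + ℕtoℚ a) *_) (expand E x) ⟩
      (x + ℕtoℚ a) * (∑[ k ≤ d ] c k * binomℚ x k)
        ≡⟨ trans (*-distribˡ-Σ≤ d (x + ℕtoℚ a) _) (Σ≤-cong d (λ k _ → term k)) ⟩
      ∑[ k ≤ d ] (same k + raised k)
        ≡⟨ Σ≤-distrib-+ d same raised ⟩
      Σ≤ d same + Σ≤ d raised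
        ≡⟨ cong₂ _+_ (Σ≤-extend same (ℕ.n≤1+n d) (λ k d<k → same-vanish k d<k)) (ℚ.+-identityˡ (Σ≤ d raised)) ⟨
      Σ≤ (suc d) same + (0ℚ + Σ≤ d raised)
        ≡⟨ cong (λ z → Σ≤ (suc d) same + (z + Σ≤ d raised)) (ℚ.*-zeroˡ (binomℚ x 0)) ⟨
      Σ≤ (suc d) same + (∑[ k ≤ suc d ] from-below k * binomℚ x k)
        ≡⟨ Σ≤-distrib-+ (suc d) same (λ k → from-below k * binomℚ x k) ⟨
      ∑[ k ≤ suc d ] (same k + from-below k * binomℚ x k)
        ≡⟨ Σ≤-cong (suc d) {λ k → coeff′ k * binomℚ x k} {λ k → same k + from-below k * binomℚ x k}
             (λ k _ → ℚ.*-distribʳ-+ (binomℚ x k) ((ℕtoℚ k + ℕtoℚ a) * c k) (from-below k)) ⟨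
      ∑[ k ≤ suc d ] coeff′ k * binomℚ x k ∎
      where
      same raised : ℕ → ℚ
      same k   = (ℕtoℚ k + ℕtoℚ a) * c k * binomℚ x k
      raised k = ℕtoℚ (suc k) * c k * binomℚ x (suc k)
      term : ∀ k → (x + ℕtoℚ a) * (c k * binomℚ x k) ≡ same k + raised k
      term k = begin
        (x + ℕtoℚ a) * (c k * binomℚ x k)
          ≡⟨ solve 3 (λ y c b → y :* (c :* b) := c :* (y :* b)) refl (x + ℕtoℚ a) (c k) (binomℚ x k) ⟩
        c k * ((x + ℕtoℚ a) * binomℚ x k)
          ≡⟨ cong (c k *_) (binomℚ-*-linear x a k) ⟩
        c k * ((ℕtoℚ k + ℕtoℚ a) * binomℚ x k + ℕtoℚ (suc k) * binomℚ x (suc k))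
          ≡⟨ solve 5 (λ c u b v b′ → c :* (u :* b :+ v :* b′) := u :* c :* b :+ v :* c :* b′) refl
               (c k) (ℕtoℚ k + ℕtoℚ a) (binomℚ x k) (ℕtoℚ (suc k)) (binomℚ x (suc k)) ⟩
        same k + raised k ∎
      same-vanish : ∀ k → d < k → same k ≡ 0ℚ
      same-vanish k d<k = begin
        (ℕtoℚ k + ℕtoℚ a) * c k * binomℚ x k  ≡⟨ cong (λ z → (ℕtoℚ k + ℕtoℚ a) * z * binomℚ x k) (vanish E k d<k) ⟩
        (ℕtoℚ k + ℕtoℚ a) * 0ℚ * binomℚ x k   ≡⟨ solve 2 (λ u b → u :* con 0ℚ :* b := con 0ℚ) refl (ℕtoℚ k + ℕtoℚ a) (binomℚ x k) ⟩
        0ℚ                                    ∎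

  expansion-*-rising : ∀ {d F} r → BinomialExpansion d F → BinomialExpansion (r ℕ.+ d) (λ x → rising x r * F x)
  expansion-*-rising zero          E = expansion-cong (λ x → sym (ℚ.*-identityˡ _)) E
  expansion-*-rising {F = F} (suc r) E = expansion-cong reassociate (expansion-*-linear r (expansion-*-rising r E))
    where
    reassociate : ∀ x → (x + ℕtoℚ r) * (rising x r * F x) ≡ rising x r * (x + ℕtoℚ r) * F x
    reassociate x = solve 3 (λ y p f → y :* (p :* f) := p :* y :* f) refl (x + ℕtoℚ r) (rising x r) (F x)

  expansion-*-mset : ∀ {d F} r → BinomialExpansion d F → BinomialExpansion (r ℕ.+ d) (λ x → mset x r * F x)
  expansion-*-mset {F = F} r E = expansion-cong reassociate (expansion-scale (inv! r) (expansion-*-rising r E))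
    where
    reassociate : ∀ x → inv! r * (rising x r * F x) ≡ rising x r * inv! r * F x
    reassociate x = solve 3 (λ i p f → i :* (p :* f) := p :* i :* f) refl (inv! r) (rising x r) (F x)

  expansion-prodℚ-mset : ∀ {m} (rs : Vec ℕ m) → BinomialExpansion (sumVec rs) (λ x → prodℚ (Vec.map (mset x) rs))
  expansion-prodℚ-mset []       = expansion-one
  expansion-prodℚ-mset (r ∷ rs) = expansion-*-mset r (expansion-prodℚ-mset rs)

  expansion-at-ℕ : ∀ {N F} (E : BinomialExpansion N F) → ∀ {j} → j ≤ N →
    F (ℕtoℚ j) ≡ ∑[ k ≤ j ] ℕtoℚ (j C k) * coeff E k
  expansion-at-ℕ {N} {F} E {j} j≤N = begin
    F (ℕtoℚ j)
      ≡⟨ expand E (ℕtoℚ j) ⟩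
    ∑[ k ≤ N ] coeff E k * binomℚ (ℕtoℚ j) k
      ≡⟨ Σ≤-cong N (λ k _ → trans (cong (coeff E k *_) (binomℚ-ℕ j k)) (ℚ.*-comm (coeff E k) _)) ⟩
    ∑[ k ≤ N ] ℕtoℚ (j C k) * coeff E k
      ≡⟨ Σ≤-extend _ j≤N (λ k j<k → trans (cong (λ c → ℕtoℚ c * coeff E k) (k>n⇒nCk≡0 j<k)) (ℚ.*-zeroˡ (coeff E k))) ⟩
    ∑[ k ≤ j ] ℕtoℚ (j C k) * coeff E k ∎

  expansion-determined : ∀ {N F} → BinomialExpansion N F → (e : ℕ → ℚ) →
    (∀ j → j ≤ N → F (ℕtoℚ j) ≡ ∑[ k ≤ j ] ℕtoℚ (j C k) * e k) →
    ∀ x → F x ≡ ∑[ k ≤ N ] e k * binomℚ x k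
  expansion-determined {N} E e values x =
    trans (expand E x) (Σ≤-cong N (λ k k≤N → cong (_* binomℚ x k) (coeff≡e k k≤N)))
    where
    coeff≡e : ∀ k → k ≤ N → coeff E k ≡ e k
    coeff≡e = unitriangular-injective ∙-cancelˡ (λ j k → ℕtoℚ (j C k)) (λ j → cong ℕtoℚ (nCn≡1 j)) N
      (λ j j≤N → trans (sym (expansion-at-ℕ E j≤N)) (values j j≤N))

  sumTo≡Σ≤ : ∀ N f → sumTo N f ≡ Σ≤ N f
  sumTo≡Σ≤ zero    f = refl
  sumTo≡Σ≤ (suc N) f = trans (cong (_+ f (suc N)) (sumTo≡Σ≤ N f)) (sym (Σ≤-last N f))

  prodℚ-mset-expansion : ∀ {m} (rs : Vec ℕ m) N → sumVec rs ≤ N → ∀ x →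
    prodℚ (Vec.map (mset x) rs) ≡ sumTo N (λ k → ℕtoℚ (ctilde rs k) * binomℚ x k)
  prodℚ-mset-expansion rs N le x = trans
    (expansion-determined (expansion-raise le (expansion-prodℚ-mset rs)) (ℕtoℚ ∘ ctilde rs) values x)
    (sym (sumTo≡Σ≤ N _))
    where
    values : ∀ j → j ≤ N → prodℚ (Vec.map (mset (ℕtoℚ j)) rs) ≡ ∑[ k ≤ j ] ℕtoℚ (j C k) * ℕtoℚ (ctilde rs k)
    values j _ = begin
      prodℚ (Vec.map (mset (ℕtoℚ j)) rs)               ≡⟨ prodℚ-mset-ℕ j rs ⟩
      ℕtoℚ (#tuples rs j)                              ≡⟨ cong ℕtoℚ (#tuples-binomial rs j) ⟩
      ℕtoℚ (ℕΣ.Σ≤ j (λ k → (j C k) ℕ.* ctilde rs k))    ≡⟨ ℕtoℚ-Σ≤ j _ ⟩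
      ∑[ k ≤ j ] ℕtoℚ ((j C k) ℕ.* ctilde rs k)         ≡⟨ Σ≤-cong j (λ k _ → ℕtoℚ-* (j C k) (ctilde rs k)) ⟩
      ∑[ k ≤ j ] ℕtoℚ (j C k) * ℕtoℚ (ctilde rs k)     ∎

open import Data.Product.Base using (_×_; _,_)
open import Data.Rational.Base using (ℚ; _*_)
open import Data.Vec.Base using (map)

mainTheorem11 :
    ((m : ℕ) → 1 ≤ m → (rs : Vec ℕ m) → (N : ℕ) → sumVec rs ≤ N → (x : ℚ) →
      prodℚ (map (mset x) rs) ≡ sumTo N (λ k → ℕtoℚ (ctilde rs k) * binomℚ x k))
    ×
    ((r₁ r₂ k : ℕ) → ctilde (r₁ ∷ r₂ ∷ []) k ≡ formula2 r₁ r₂ k)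
-- The expansion also holds for m = 0.
mainTheorem11 = (λ m _ rs → prodℚ-mset-expansion rs) , ctilde-pair≡formula2
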